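{- Let $\mathcal{N}=(\alpha,\alpha^2,\ldots,\alpha^{2^{n-1}})$ be a normal basis of $\mathbf{F}_{2^n}/\mathbf{F}_2$. 1. There exists $\beta\in\mathbf{F}_{2^{2n}}\setminus\mathbf{F}_{2^n}$ with $\beta^2+\beta=\alpha$ (so that $\mathcal{N}\cup\beta\mathcal{N}$ is a basis of $\mathbf{F}_{2^{2n}}/\mathbf{F}_2$). For such $\beta$: (a) the polynomial $X^2+X+\beta$ is irreducible over $\mathbf{F}_{2^{2n}}$ if and only if $n$ is odd; (b) assuming $3$ divides $2^{2n}-1$, the polynomial $X^3+\beta$ is irreducible over $\mathbf{F}_{2^{2n}}$ if and only if the class of $\beta$ generates $\mathbf{F}_{2^{2n}}^*/\mathbf{F}_{2^{2n}}^{*3}$. 2. Assume $3$ divides $2^n-1$ and let $\beta\in\mathbf{F}_{2^{3n}}\setminus\mathbf{F}_{2^n}$ satisfy $\beta^3=\alpha$ (so that $\mathcal{N}\cup\beta\mathcal{N}\cup\beta^2\mathcal{N}$ is a basis of $\mathbf{F}_{2^{3n}}/\mathbf{F}_2$). Then: (a) the polynomial $X^2+X+\beta$ is reducible over $\mathbf{F}_{2^{3n}}$; (b) if moreover $\alpha$ generates $\mathbf{F}_{2^n}^*$ and the $3$-adic valuation satisfies $v_3\big(\frac{2^{3n}-1}{2^n-1}\big)=1$, then $X^3+\beta$ is irreducible over $\mathbf{F}_{2^{3n}}$.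
   Context: $\mathbf{F}_{2^{2n}}^{*3}$ denotes the subgroup of cubes in $\mathbf{F}_{2^{2n}}^*$. A normal basis of $\mathbf{F}_{2^n}/\mathbf{F}_2$ is a basis of the form $(\alpha^{2^i})_{0\le i\le n-1}$. -}

module Defs where

open import Level using (0ℓ)
open import Algebra.Bundles using (CommutativeRing)
open import Algebra.Morphism.Structures using (module RingMorphisms)
open import Data.Nat using (ℕ; zero; suc)
import Data.Nat as ℕ
open import Data.Nat.Divisibility using (_∣_)
open import Data.Fin using (Fin; toℕ)
import Data.Fin as Fin
open import Data.Bool using (Bool; true; false; if_then_else_)
open import Data.List using (List; []; _∷_; map)
open import Data.Product using (Σ; ∃; ∃₂; _×_; _,_)
open import Data.Sum using (_⊎_)
open import Relation.Nullary using (¬_)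
open import Relation.Binary.PropositionalEquality using (_≡_)
import Relation.Binary.PropositionalEquality as ≡
open import Function.Bundles using (Inverse)

IsField : CommutativeRing 0ℓ 0ℓ → Set
IsField R = ¬ (0# ≈ 1#) × (∀ x → ¬ (x ≈ 0#) → ∃ λ y → x * y ≈ 1#)
  where open CommutativeRing R

-- A finite field with exactly q elements (q = 2^n gives F_{2^n},
-- unique up to isomorphism).
record FiniteField (q : ℕ) : Set₁ where
  field
    cring   : CommutativeRing 0ℓ 0ℓ
    isField : IsField cring
    card    : Inverse (≡.setoid (Fin q)) (CommutativeRing.setoid cring)
  open CommutativeRing cring public

-- A field embedding k ↪ K (ring homomorphisms of fields are injective);
-- we identify k with its image in K.
IsEmbedding : ∀ {q r} (k : FiniteField q) (K : FiniteField r) →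
              (FiniteField.Carrier k → FiniteField.Carrier K) → Set
IsEmbedding k K ι =
  RingMorphisms.IsRingHomomorphism (CommutativeRing.rawRing (FiniteField.cring k))
                                   (CommutativeRing.rawRing (FiniteField.cring K)) ι

module _ {q : ℕ} (F : FiniteField q) where
  open FiniteField F
  pow : Carrier → ℕ → Carrier
  pow x zero    = 1#
  pow x (suc j) = x * pow x j

  sum : ∀ {n} → (Fin n → Carrier) → Carrier
  sum {zero}  f = 0#
  sum {suc n} f = f Fin.zero + sum (λ i → f (Fin.suc i))

  NonZero : Carrier → Set
  NonZero x = ¬ (x ≈ 0#)

  -- (α^{2^i})_{0 ≤ i < n} is a basis of F over F_2 (a normal basis).
  -- F_2-linear combinations: coefficients c : Fin n → Bool (false = 0, true = 1).
  linComb : ∀ {n} → (Fin n → Carrier) → (Fin n → Bool) → Carrier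
  linComb e c = sum (λ i → if c i then e i else 0#)

  IsNormalBasis : ℕ → Carrier → Set
  IsNormalBasis n α =
    (∀ (c : Fin n → Bool) → linComb e c ≈ 0# → ∀ i → c i ≡ false) ×
    (∀ x → ∃ λ (c : Fin n → Bool) → linComb e c ≈ x)
    where e : Fin n → Carrier
          e i = pow α (2 ℕ.^ toℕ i)

  GeneratesUnits : Carrier → Set
  GeneratesUnits α = ∀ x → NonZero x → ∃ λ j → x ≈ pow α j

  -- the class of β generates F^* / F^{*3}: every nonzero x is β^j times a
  -- nonzero cube  (β is assumed nonzero where this is used)
  GeneratesModCubes : Carrier → Set
  GeneratesModCubes β = ∀ x → NonZero x → ∃₂ λ j y → NonZero y × x ≈ pow β j * pow y 3

  -- Univariate polynomials over F, as coefficient lists (lowest degree first)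

  Poly : Set
  Poly = List Carrier

  coeff : Poly → ℕ → Carrier
  coeff []      _       = 0#
  coeff (a ∷ p) zero    = a
  coeff (a ∷ p) (suc i) = coeff p i

  _+ₚ_ : Poly → Poly → Poly
  []      +ₚ q       = q
  (a ∷ p) +ₚ []      = a ∷ p
  (a ∷ p) +ₚ (b ∷ q) = (a + b) ∷ (p +ₚ q)

  _*ₚ_ : Poly → Poly → Poly
  []      *ₚ q = []
  (a ∷ p) *ₚ q = map (a *_) q +ₚ (0# ∷ (p *ₚ q))

  _≈ₚ_ : Poly → Poly → Set
  p ≈ₚ q = ∀ i → coeff p i ≈ coeff q i

  IsConstant : Poly → Set
  IsConstant p = ∀ i → coeff p (suc i) ≈ 0#

  -- irreducible over the field F: not constant (i.e. nonzero and not a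
  -- unit), and in every factorisation one factor is constant (a unit).
  Irreducible : Poly → Set
  Irreducible p = ¬ IsConstant p × (∀ f g → p ≈ₚ (f *ₚ g) → IsConstant f ⊎ IsConstant g)

  quadPoly : Carrier → Poly
  quadPoly β = β ∷ 1# ∷ 1# ∷ []

  cubePoly : Carrier → Poly
  cubePoly β = β ∷ 0# ∷ 0# ∷ 1# ∷ []

InImage : ∀ {q r} (k : FiniteField q) (K : FiniteField r) →
          (FiniteField.Carrier k → FiniteField.Carrier K) → FiniteField.Carrier K → Set
InImage k K ι β = ∃ λ a → FiniteField._≈_ K (ι a) β

V3QuotientIsOne : ℕ → ℕ → Set
V3QuotientIsOne a b = ∃ λ m → m ℕ.* b ≡ a × 3 ∣ m × ¬ (9 ∣ m)

{-# OPTIONS --safe #-}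
module Submission where

-- Over F = F_{2^m}, y = x² + x is solvable iff Tr y = 0 (Artin–Schreier), and if 2^m = 1 + 3e a unit y
-- is a cube iff y^e = 1; a polynomial of degree 2 or 3 is irreducible iff it has no root.
-- Part 1: Tr_K(ια) = Tr_k(ια + (ια)^q) = 0 yields β, and β ∉ k since Tr_k α, the sum of the normal
-- basis, is nonzero. Hence β^q = β + 1 and Tr_K β = Tr_k(1) = n mod 2. X³ + β is irreducible iff β is
-- not a cube, iff β^e ≠ 1, and then x^e ∈ {1, β^e, β^(2e)} places x in the coset of 1, β or β².
-- Part 2: ω = β^(q-1) is a cube root of unity, ω ≠ 1 as β ∉ k, and ω ∈ k when 3 | q - 1, so
-- Tr_K β = Tr_k(β + βω + βω²) = 0 and X² + X + β has a root. If β = r³, write 2^(3n) - 1 = 3s(q - 1)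
-- with 3 ∤ s; then ω^s = r^(2^(3n)-1) = 1 and ω³ = 1 force ω = 1.

open import Defs
open import Algebra.Bundles using (CommutativeRing)
open import Algebra.Morphism.Structures using (module RingMorphisms)
import Algebra.Properties.CommutativeMonoid.Sum as MonoidSum
open import Data.Bool using (true; false)
open import Data.Empty using (⊥-elim)
open import Data.Fin using (Fin; toℕ; punchIn)
import Data.Fin as Fin
import Data.Fin.Properties as Finₚ
open import Data.Fin.Permutation using (Permutation; permutation)
open import Data.List using ([]; _∷_; map; length)
import Data.Nat as ℕ
open import Data.Nat.Divisibility using (_∣_; divides; m%n≡0⇒n∣m)
open import Data.Nat.DivMod using (m≡m%n+[m/n]*n; m%n<n)
open ℕ using (ℕ; zero; suc; z≤n; s≤s)
import Data.Nat.Properties as ℕₚ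
open import Data.Product using (∃; ∃₂; _×_; _,_; proj₁; proj₂)
open import Data.Sum using (_⊎_; inj₁; inj₂)
open import Function.Bundles using (Inverse; Equivalence; _⇔_; mk⇔)
import Function.Properties.Equivalence as ⇔
open import Relation.Binary.Definitions using (Decidable; tri<; tri≈; tri>)
open import Relation.Binary.PropositionalEquality as ≡ using (_≡_; _≢_)
open import Relation.Nullary using (¬_; Dec; yes; no)
import Relation.Nullary.Decidable as Dec

module FieldProperties {q : ℕ} (F : FiniteField q) where

  open FiniteField F public
  open Inverse card using (to; from; from-cong; strictlyInverseˡ; strictlyInverseʳ)
  open import Algebra.Properties.CommutativeSemiring.Exp commutativeSemiring public
  open import Algebra.Properties.Ring ring public using (-‿distribˡ-*; -1*x≈-x; -‿involutive; x∙y⁻¹≈ε⇒x≈y)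
  open import Algebra.Solver.Ring.NaturalCoefficients.Default commutativeSemiring public
    using (solve; _:=_; _:+_; _:*_; con)
  open import Relation.Binary.Reasoning.Setoid setoid public

  pow≡^ : ∀ x n → pow F x n ≡ x ^ n
  pow≡^ x zero    = ≡.refl
  pow≡^ x (suc n) = ≡.cong (x *_) (pow≡^ x n)

  from-injective : ∀ {x y} → from x ≡ from y → x ≈ y
  from-injective {x} {y} eq = begin
    x           ≈⟨ strictlyInverseˡ x ⟨
    to (from x) ≡⟨ ≡.cong to eq ⟩
    to (from y) ≈⟨ strictlyInverseˡ y ⟩
    y           ∎

  element : Fin q → Carrier
  element = to

  element-injective : ∀ {i j} → element i ≈ element j → i ≡ j
  element-injective {i} {j} eq = ≡.trans (≡.sym (strictlyInverseʳ i)) (≡.trans (from-cong eq) (strictlyInverseʳ j))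

  infix 4 _≟_
  _≟_ : Decidable _≈_
  x ≟ y = Dec.map′ from-injective from-cong (from x Fin.≟ from y)

  0≉1 : 0# ≉ 1#
  0≉1 = proj₁ isField

  1≉0 : 1# ≉ 0#
  1≉0 1≈0 = 0≉1 (sym 1≈0)

  1<q : 1 ℕ.< q
  1<q = distinct⇒1<n (from 0#) (from 1#) (λ eq → 0≉1 (from-injective eq))
    where
      distinct⇒1<n : ∀ {n} (i j : Fin n) → i ≢ j → 1 ℕ.< n
      distinct⇒1<n {suc zero}    Fin.zero Fin.zero i≢j = ⊥-elim (i≢j ≡.refl)
      distinct⇒1<n {suc (suc n)} _        _        _   = s≤s (s≤s z≤n)

  module _ (P : Carrier → Set) (P? : ∀ x → Dec (P x)) (resp : ∀ {x y} → x ≈ y → P x → P y) where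

    ¬∀⇒∃¬ : ¬ (∀ x → P x) → ∃ λ x → ¬ P x
    ¬∀⇒∃¬ ¬∀P with Finₚ.¬∀⟶∃¬ q (λ i → P (to i)) (λ i → P? (to i))
                                  (λ ∀P → ¬∀P (λ x → resp (strictlyInverseˡ x) (∀P (from x))))
    ... | i , ¬Pi = to i , ¬Pi

    ¬∀¬⇒∃ : ¬ (∀ x → ¬ P x) → ∃ P
    ¬∀¬⇒∃ ¬∀¬P with Finₚ.any? (λ i → P? (to i))
    ... | yes (i , Pi) = to i , Pi
    ... | no ¬∃P       = ⊥-elim (¬∀¬P (λ x Px → ¬∃P (from x , resp (sym (strictlyInverseˡ x)) Px)))

  *-cancelˡ : ∀ {a x y} → a ≉ 0# → a * x ≈ a * y → x ≈ y
  *-cancelˡ {a} {x} {y} a≉0 ax≈ay with proj₂ isField a a≉0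
  ... | a⁻¹ , aa⁻¹≈1 = begin
    x                ≈⟨ a⁻¹[a*z]≈z x ⟨
    a⁻¹ * (a * x)    ≈⟨ *-congˡ ax≈ay ⟩
    a⁻¹ * (a * y)    ≈⟨ a⁻¹[a*z]≈z y ⟩
    y                ∎
    where
      a⁻¹[a*z]≈z : ∀ z → a⁻¹ * (a * z) ≈ z
      a⁻¹[a*z]≈z z = begin
        a⁻¹ * (a * z)  ≈⟨ solve 3 (λ a a⁻¹ z → a⁻¹ :* (a :* z) := (a :* a⁻¹) :* z) refl a a⁻¹ z ⟩
        (a * a⁻¹) * z  ≈⟨ *-congʳ aa⁻¹≈1 ⟩
        1# * z         ≈⟨ *-identityˡ z ⟩
        z              ∎

  *-cancelʳ : ∀ {a x y} → a ≉ 0# → x * a ≈ y * a → x ≈ y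
  *-cancelʳ {a} {x} {y} a≉0 xa≈ya = *-cancelˡ a≉0 (trans (*-comm a x) (trans xa≈ya (*-comm y a)))

  x*y≈0⇒x≈0∨y≈0 : ∀ {x y} → x * y ≈ 0# → x ≈ 0# ⊎ y ≈ 0#
  x*y≈0⇒x≈0∨y≈0 {x} {y} xy≈0 with x ≟ 0#
  ... | yes x≈0 = inj₁ x≈0
  ... | no  x≉0 = inj₂ (*-cancelˡ x≉0 (trans xy≈0 (sym (zeroʳ x))))

  *-≉0 : ∀ {x y} → x ≉ 0# → y ≉ 0# → x * y ≉ 0#
  *-≉0 x≉0 y≉0 xy≈0 with x*y≈0⇒x≈0∨y≈0 xy≈0
  ... | inj₁ x≈0 = x≉0 x≈0
  ... | inj₂ y≈0 = y≉0 y≈0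

  ^-≉0 : ∀ {x} n → x ≉ 0# → x ^ n ≉ 0#
  ^-≉0 zero    x≉0 = 1≉0
  ^-≉0 (suc n) x≉0 = *-≉0 x≉0 (^-≉0 n x≉0)

  ^≉0⇒≉0 : ∀ {x} n → x ^ suc n ≉ 0# → x ≉ 0#
  ^≉0⇒≉0 n xⁿ⁺¹≉0 x≈0 = xⁿ⁺¹≉0 (trans (*-congʳ x≈0) (zeroˡ _))

  1^n≈1 : ∀ n → 1# ^ n ≈ 1#
  1^n≈1 zero    = refl
  1^n≈1 (suc n) = trans (*-identityˡ _) (1^n≈1 n)

  ^-comm : ∀ x m n → (x ^ m) ^ n ≈ (x ^ n) ^ m
  ^-comm x m n = trans (^-assocʳ x m n) (trans (^-congʳ x (ℕₚ.*-comm m n)) (sym (^-assocʳ x n m)))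

  x³≈1∧xˢ≈1⇒x≈1 : ∀ {x} s → ¬ 3 ∣ s → x ^ 3 ≈ 1# → x ^ s ≈ 1# → x ≈ 1#
  x³≈1∧xˢ≈1⇒x≈1 {x} s 3∤s x³≈1 xˢ≈1 = from-remainder (s ℕ.% 3) ≡.refl (m%n<n s 3)
    where
      x^[s%3]≈1 : x ^ (s ℕ.% 3) ≈ 1#
      x^[s%3]≈1 = begin
        x ^ (s ℕ.% 3)                              ≈⟨ *-identityʳ _ ⟨
        x ^ (s ℕ.% 3) * 1#                         ≈⟨ *-congˡ (trans (sym (1^n≈1 (s ℕ./ 3))) (^-congˡ (s ℕ./ 3) (sym x³≈1))) ⟩
        x ^ (s ℕ.% 3) * (x ^ 3) ^ (s ℕ./ 3)        ≈⟨ *-congˡ (trans (^-assocʳ x 3 (s ℕ./ 3)) (^-congʳ x (ℕₚ.*-comm 3 (s ℕ./ 3)))) ⟩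
        x ^ (s ℕ.% 3) * x ^ (s ℕ./ 3 ℕ.* 3)        ≈⟨ ^-homo-* x (s ℕ.% 3) _ ⟨
        x ^ (s ℕ.% 3 ℕ.+ s ℕ./ 3 ℕ.* 3)            ≈⟨ ^-congʳ x (m≡m%n+[m/n]*n s 3) ⟨
        x ^ s                                      ≈⟨ xˢ≈1 ⟩
        1#                                         ∎
      from-remainder : ∀ r → s ℕ.% 3 ≡ r → r ℕ.< 3 → x ≈ 1#
      from-remainder 0 s%3≡0 _ = ⊥-elim (3∤s (m%n≡0⇒n∣m s 3 s%3≡0))
      from-remainder 1 s%3≡1 _ = trans (sym (*-identityʳ x)) (trans (reflexive (≡.cong (x ^_) (≡.sym s%3≡1))) x^[s%3]≈1)
      from-remainder 2 s%3≡2 _ = begin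
        x               ≈⟨ *-identityʳ x ⟨
        x * 1#          ≈⟨ *-congˡ (trans (reflexive (≡.cong (x ^_) (≡.sym s%3≡2))) x^[s%3]≈1) ⟨
        x * x ^ 2       ≈⟨ x³≈1 ⟩
        1#              ∎
      from-remainder (suc (suc (suc r))) _ (s≤s (s≤s (s≤s ())))

  private
    module ∏ = MonoidSum *-commutativeMonoid

    ∏-≉0 : ∀ {n} (f : Fin n → Carrier) → (∀ i → f i ≉ 0#) → ∏.sum f ≉ 0#
    ∏-≉0 {zero}  f f≉0 = 1≉0
    ∏-≉0 {suc n} f f≉0 = *-≉0 (f≉0 Fin.zero) (∏-≉0 (λ i → f (Fin.suc i)) (λ i → f≉0 (Fin.suc i)))

    ∏-const-but-one : ∀ {n e} → n ≡ suc e → ∀ x (f : Fin n → Carrier) i →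
                      f i ≈ 1# → (∀ j → j ≢ i → f j ≈ x) → ∏.sum f ≈ x ^ e
    ∏-const-but-one {e = e} ≡.refl x f i fi≈1 fj≈x = begin
      ∏.sum f                                    ≈⟨ ∏.sum-remove {i = i} f ⟩
      f i * ∏.sum {e} (λ j → f (punchIn i j))    ≈⟨ *-cong fi≈1 (∏.sum-cong-≋ (λ j → fj≈x _ (Finₚ.punchInᵢ≢i i j))) ⟩
      1# * ∏.sum {e} (λ _ → x)                   ≈⟨ *-identityˡ _ ⟩
      ∏.sum {e} (λ _ → x)                        ≈⟨ ∏.sum-replicate e ⟩
      x ^ e                                  ∎

    -- the product of nonzeroOr1 over F is the product of the units of F
    nonzeroOr1 : Carrier → Carrier
    nonzeroOr1 y with y ≟ 0#
    ... | yes _ = 1#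
    ... | no  _ = y

    scaling : Carrier → Carrier → Carrier
    scaling x y with y ≟ 0#
    ... | yes _ = 1#
    ... | no  _ = x

    scaling-≈0 : ∀ x {y} → y ≈ 0# → scaling x y ≈ 1#
    scaling-≈0 x {y} y≈0 with y ≟ 0#
    ... | yes _   = refl
    ... | no  y≉0 = ⊥-elim (y≉0 y≈0)

    scaling-≉0 : ∀ x {y} → y ≉ 0# → scaling x y ≈ x
    scaling-≉0 x {y} y≉0 with y ≟ 0#
    ... | yes y≈0 = ⊥-elim (y≉0 y≈0)
    ... | no  _   = refl

    nonzeroOr1-≉0 : ∀ y → nonzeroOr1 y ≉ 0#
    nonzeroOr1-≉0 y with y ≟ 0#
    ... | yes _   = 1≉0
    ... | no  y≉0 = y≉0

    nonzeroOr1-cong : ∀ {y z} → y ≈ z → nonzeroOr1 y ≈ nonzeroOr1 z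
    nonzeroOr1-cong {y} {z} y≈z with y ≟ 0# | z ≟ 0#
    ... | yes _   | yes _   = refl
    ... | yes y≈0 | no  z≉0 = ⊥-elim (z≉0 (trans (sym y≈z) y≈0))
    ... | no  y≉0 | yes z≈0 = ⊥-elim (y≉0 (trans y≈z z≈0))
    ... | no  _   | no  _   = y≈z

    nonzeroOr1-* : ∀ {x} → x ≉ 0# → ∀ y → nonzeroOr1 (x * y) ≈ scaling x y * nonzeroOr1 y
    nonzeroOr1-* {x} x≉0 y with y ≟ 0# | x * y ≟ 0#
    ... | yes _   | yes _    = sym (*-identityˡ 1#)
    ... | yes y≈0 | no xy≉0  = ⊥-elim (xy≉0 (trans (*-congˡ y≈0) (zeroʳ x)))
    ... | no  y≉0 | yes xy≈0 = ⊥-elim (*-≉0 x≉0 y≉0 xy≈0)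
    ... | no  _   | no  _    = refl

    *-permutation : ∀ {x} → x ≉ 0# → Permutation q q
    *-permutation {x} x≉0 with proj₂ isField x x≉0
    ... | x⁻¹ , xx⁻¹≈1 = permutation (λ i → from (x * to i)) (λ i → from (x⁻¹ * to i))
                                     (λ i → cancel x x⁻¹ xx⁻¹≈1 i)
                                     (λ i → cancel x⁻¹ x (trans (*-comm x⁻¹ x) xx⁻¹≈1) i)
      where
        cancel : ∀ a b → a * b ≈ 1# → ∀ i → from (a * to (from (b * to i))) ≡ i
        cancel a b ab≈1 i = ≡.trans (from-cong (begin
          a * to (from (b * to i))  ≈⟨ *-congˡ (strictlyInverseˡ _) ⟩
          a * (b * to i)            ≈⟨ *-assoc a b (to i) ⟨
          (a * b) * to i            ≈⟨ *-congʳ ab≈1 ⟩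
          1# * to i                 ≈⟨ *-identityˡ (to i) ⟩
          to i                      ∎)) (strictlyInverseʳ i)

  -- multiplication by x permutes F and multiplies each of its q - 1 units by x
  fermat-little : ∀ {e} → q ≡ suc e → ∀ {x} → x ≉ 0# → x ^ e ≈ 1#
  fermat-little {e} q≡1+e {x} x≉0 = *-cancelʳ (∏-≉0 h (λ i → nonzeroOr1-≉0 (to i))) (begin
    x ^ e * ∏.sum h                                 ≈⟨ *-congʳ ∏scaling≈xᵉ ⟨
    ∏.sum (λ i → scaling x (to i)) * ∏.sum h        ≈⟨ ∏.∑-distrib-+ (λ i → scaling x (to i)) h ⟨
    ∏.sum (λ i → scaling x (to i) * h i)            ≈⟨ ∏.sum-cong-≋ (λ i → nonzeroOr1-* x≉0 (to i)) ⟨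
    ∏.sum (λ i → nonzeroOr1 (x * to i))             ≈⟨ ∏.sum-cong-≋ (λ i → nonzeroOr1-cong (strictlyInverseˡ (x * to i))) ⟨
    ∏.sum (λ i → h (from (x * to i)))               ≈⟨ ∏.sum-permute h (*-permutation x≉0) ⟨
    ∏.sum h                                         ≈⟨ *-identityˡ _ ⟨
    1# * ∏.sum h                                    ∎)
    where
      h : Fin q → Carrier
      h i = nonzeroOr1 (to i)
      ∏scaling≈xᵉ : ∏.sum (λ i → scaling x (to i)) ≈ x ^ e
      ∏scaling≈xᵉ = ∏-const-but-one q≡1+e x (λ i → scaling x (to i)) (from 0#)
        (scaling-≈0 x (strictlyInverseˡ 0#))
        (λ j j≢i₀ → scaling-≉0 x (λ toj≈0 → j≢i₀ (≡.trans (≡.sym (strictlyInverseʳ j)) (from-cong toj≈0))))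

  q≡1+[q∸1] : q ≡ suc (q ℕ.∸ 1)
  q≡1+[q∸1] = ≡.sym (ℕₚ.m+[n∸m]≡n (ℕₚ.<⇒≤ 1<q))

  3∣q∸1⇒q≡1+3e : 3 ∣ q ℕ.∸ 1 → ∃ λ e → q ≡ suc (e ℕ.* 3)
  3∣q∸1⇒q≡1+3e (divides e q∸1≡e*3) = e , ≡.trans q≡1+[q∸1] (≡.cong suc q∸1≡e*3)

  x^q≈x : ∀ x → x ^ q ≈ x
  x^q≈x x with x ≟ 0#
  ... | yes x≈0 = begin
    x ^ q                  ≈⟨ ^-congʳ x q≡1+[q∸1] ⟩
    x * x ^ (q ℕ.∸ 1)       ≈⟨ *-congʳ x≈0 ⟩
    0# * x ^ (q ℕ.∸ 1)      ≈⟨ zeroˡ _ ⟩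
    0#                     ≈⟨ x≈0 ⟨
    x                      ∎
  ... | no x≉0 = begin
    x ^ q                  ≈⟨ ^-congʳ x q≡1+[q∸1] ⟩
    x * x ^ (q ℕ.∸ 1)       ≈⟨ *-congˡ (fermat-little q≡1+[q∸1] x≉0) ⟩
    x * 1#                 ≈⟨ *-identityʳ x ⟩
    x                      ∎

module Sums {q : ℕ} (F : FiniteField q) where

  open FieldProperties F

  ∑< : ℕ → (ℕ → Carrier) → Carrier
  ∑< zero    f = 0#
  ∑< (suc k) f = f 0 + ∑< k (λ i → f (suc i))

  infix 6.5 ∑<
  syntax ∑< k (λ i → x) = ∑[ i < k ] x

  ∑-cong : ∀ k {f g} → (∀ i → f i ≈ g i) → ∑< k f ≈ ∑< k g
  ∑-cong zero    f≈g = refl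
  ∑-cong (suc k) f≈g = +-cong (f≈g 0) (∑-cong k (λ i → f≈g (suc i)))

  ∑-+ : ∀ k f g → ∑[ i < k ] (f i + g i) ≈ ∑< k f + ∑< k g
  ∑-+ zero    f g = sym (+-identityˡ 0#)
  ∑-+ (suc k) f g = trans (+-congˡ (∑-+ k (λ i → f (suc i)) (λ i → g (suc i))))
    (solve 4 (λ a b c d → (a :+ b) :+ (c :+ d) := (a :+ c) :+ (b :+ d)) refl _ _ _ _)

  ∑-*ˡ : ∀ k a f → ∑[ i < k ] (a * f i) ≈ a * ∑< k f
  ∑-*ˡ zero    a f = sym (zeroʳ a)
  ∑-*ˡ (suc k) a f = trans (+-congˡ (∑-*ˡ k a (λ i → f (suc i)))) (sym (distribˡ a _ _))

  ∑-0 : ∀ k → ∑[ i < k ] 0# ≈ 0#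
  ∑-0 zero    = refl
  ∑-0 (suc k) = trans (+-identityˡ _) (∑-0 k)

  ∑-last : ∀ k f → ∑< (suc k) f ≈ ∑< k f + f k
  ∑-last zero    f = trans (+-identityʳ _) (sym (+-identityˡ _))
  ∑-last (suc k) f = trans (+-congˡ (∑-last k (λ i → f (suc i)))) (sym (+-assoc _ _ _))

  sum≈∑ : ∀ j {g : Fin j → Carrier} (f : ℕ → Carrier) → (∀ i → g i ≈ f (toℕ i)) → sum F g ≈ ∑< j f
  sum≈∑ zero    f g≈f = refl
  sum≈∑ (suc j) f g≈f = +-cong (g≈f Fin.zero) (sum≈∑ j (λ i → f (suc i)) (λ i → g≈f (Fin.suc i)))

  ∑-split : ∀ a b f → ∑< (a ℕ.+ b) f ≈ ∑< a f + ∑< b (λ i → f (a ℕ.+ i))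
  ∑-split zero    b f = sym (+-identityˡ _)
  ∑-split (suc a) b f = trans (+-congˡ (∑-split a b (λ i → f (suc i)))) (sym (+-assoc _ _ _))

module Polynomials {q : ℕ} (F : FiniteField q) where

  open FieldProperties F

  eval : Poly F → Carrier → Carrier
  eval []      x = 0#
  eval (a ∷ p) x = a + x * eval p x

  eval-+ₚ : ∀ p r x → eval (_+ₚ_ F p r) x ≈ eval p x + eval r x
  eval-+ₚ []      r       x = sym (+-identityˡ _)
  eval-+ₚ (a ∷ p) []      x = sym (+-identityʳ _)
  eval-+ₚ (a ∷ p) (b ∷ r) x = begin
    (a + b) + x * eval (_+ₚ_ F p r) x          ≈⟨ +-congˡ (*-congˡ (eval-+ₚ p r x)) ⟩
    (a + b) + x * (eval p x + eval r x)        ≈⟨ solve 5 (λ a b x u v → (a :+ b) :+ x :* (u :+ v) := (a :+ x :* u) :+ (b :+ x :* v)) refl a b x (eval p x) (eval r x) ⟩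
    (a + x * eval p x) + (b + x * eval r x)    ∎

  eval-*ₚ : ∀ p r x → eval (_*ₚ_ F p r) x ≈ eval p x * eval r x
  eval-*ₚ []      r x = sym (zeroˡ _)
  eval-*ₚ (a ∷ p) r x = begin
    eval (_+ₚ_ F (map (a *_) r) (0# ∷ _*ₚ_ F p r)) x    ≈⟨ eval-+ₚ (map (a *_) r) (0# ∷ _*ₚ_ F p r) x ⟩
    eval (map (a *_) r) x + (0# + x * eval (_*ₚ_ F p r) x)
                                                      ≈⟨ +-cong (eval-scale r) (+-congˡ (*-congˡ (eval-*ₚ p r x))) ⟩
    a * eval r x + (0# + x * (eval p x * eval r x))    ≈⟨ solve 4 (λ a x u v → a :* v :+ (con 0 :+ x :* (u :* v)) := (a :+ x :* u) :* v) refl a x (eval p x) (eval r x) ⟩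
    (a + x * eval p x) * eval r x                     ∎
    where
      eval-scale : ∀ r → eval (map (a *_) r) x ≈ a * eval r x
      eval-scale []      = sym (zeroʳ a)
      eval-scale (b ∷ r) = trans (+-congˡ (*-congˡ (eval-scale r)))
        (solve 4 (λ a b x u → a :* b :+ x :* (a :* u) := a :* (b :+ x :* u)) refl a b x (eval r x))

  eval-≈ₚ[] : ∀ p x → _≈ₚ_ F p [] → eval p x ≈ 0#
  eval-≈ₚ[] []      x p≈0 = refl
  eval-≈ₚ[] (a ∷ p) x p≈0 = begin
    a + x * eval p x  ≈⟨ +-cong (p≈0 0) (*-congˡ (eval-≈ₚ[] p x (λ i → p≈0 (suc i)))) ⟩
    0# + x * 0#       ≈⟨ +-identityˡ _ ⟩
    x * 0#            ≈⟨ zeroʳ x ⟩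
    0#                ∎

  eval-≈ₚ : ∀ p r x → _≈ₚ_ F p r → eval p x ≈ eval r x
  eval-≈ₚ []      r       x p≈r = sym (eval-≈ₚ[] r x (λ i → sym (p≈r i)))
  eval-≈ₚ (a ∷ p) []      x p≈r = eval-≈ₚ[] (a ∷ p) x p≈r
  eval-≈ₚ (a ∷ p) (b ∷ r) x p≈r = +-cong (p≈r 0) (*-congˡ (eval-≈ₚ p r x (λ i → p≈r (suc i))))

  -- synthetic division by X - r (the remainder is eval p r)
  quotientBy : Carrier → Poly F → Poly F
  quotientBy r []          = []
  quotientBy r (a ∷ [])    = []
  quotientBy r (a ∷ b ∷ p) = eval (b ∷ p) r ∷ quotientBy r (b ∷ p)

  length-quotientBy : ∀ r a p → length (quotientBy r (a ∷ p)) ≡ length p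
  length-quotientBy r a []      = ≡.refl
  length-quotientBy r a (b ∷ p) = ≡.cong suc (length-quotientBy r b p)

  -- p(x) - p(r) = (x - r) Q(x), with the subtractions moved across
  eval-quotientBy : ∀ r p x → eval p x + r * eval (quotientBy r p) x ≈ eval p r + x * eval (quotientBy r p) x
  eval-quotientBy r []          x = +-congˡ (trans (zeroʳ r) (sym (zeroʳ x)))
  eval-quotientBy r (a ∷ [])    x = +-cong (+-congˡ (trans (zeroʳ x) (sym (zeroʳ r)))) (trans (zeroʳ r) (sym (zeroʳ x)))
  eval-quotientBy r (a ∷ b ∷ p) x = begin
    (a + x * E) + r * (e + x * Q)   ≈⟨ solve 6 (λ a x r E e Q → (a :+ x :* E) :+ r :* (e :+ x :* Q) := (a :+ r :* e) :+ x :* (E :+ r :* Q)) refl a x r E e Q ⟩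
    (a + r * e) + x * (E + r * Q)   ≈⟨ +-congˡ (*-congˡ (eval-quotientBy r (b ∷ p) x)) ⟩
    (a + r * e) + x * (e + x * Q)   ∎
    where
      E = eval (b ∷ p) x
      e = eval (b ∷ p) r
      Q = eval (quotientBy r (b ∷ p)) x

  quotientBy-≈ₚ[] : ∀ r p → _≈ₚ_ F (quotientBy r p) [] → eval p r ≈ 0# → _≈ₚ_ F p []
  quotientBy-≈ₚ[] r []          Q≈0 pr≈0 i       = refl
  quotientBy-≈ₚ[] r (a ∷ [])    Q≈0 pr≈0 zero    = trans (sym (trans (+-congˡ (zeroʳ r)) (+-identityʳ a))) pr≈0
  quotientBy-≈ₚ[] r (a ∷ [])    Q≈0 pr≈0 (suc i) = refl
  quotientBy-≈ₚ[] r (a ∷ b ∷ p) Q≈0 pr≈0 zero    = trans (sym (trans (+-congˡ (trans (*-congˡ (Q≈0 0)) (zeroʳ r))) (+-identityʳ a))) pr≈0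
  quotientBy-≈ₚ[] r (a ∷ b ∷ p) Q≈0 pr≈0 (suc i) = quotientBy-≈ₚ[] r (b ∷ p) (λ i → Q≈0 (suc i)) (Q≈0 0) i

  distinctRoots⇒≈ₚ[] : ∀ {N} (root : Fin N → Carrier) → (∀ i j → root i ≈ root j → i ≡ j) →
                       ∀ p → length p ℕ.≤ N → (∀ i → eval p (root i) ≈ 0#) → _≈ₚ_ F p []
  distinctRoots⇒≈ₚ[] root injective [] _ _ i = refl
  distinctRoots⇒≈ₚ[] {suc N} root injective (a ∷ p) (s≤s |p|≤N) roots =
    quotientBy-≈ₚ[] r (a ∷ p)
      (distinctRoots⇒≈ₚ[] (λ i → root (Fin.suc i)) (λ i j eq → Finₚ.suc-injective (injective _ _ eq))
        Q (≡.subst (ℕ._≤ N) (≡.sym (length-quotientBy r a p)) |p|≤N) Q-roots)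
      (roots Fin.zero)
    where
      r = root Fin.zero
      Q = quotientBy r (a ∷ p)
      xQ≈rQ : ∀ x → eval (a ∷ p) x ≈ 0# → x * eval Q x ≈ r * eval Q x
      xQ≈rQ x px≈0 = begin
        x * eval Q x                    ≈⟨ +-identityˡ _ ⟨
        0# + x * eval Q x               ≈⟨ +-congʳ (roots Fin.zero) ⟨
        eval (a ∷ p) r + x * eval Q x   ≈⟨ eval-quotientBy r (a ∷ p) x ⟨
        eval (a ∷ p) x + r * eval Q x   ≈⟨ +-congʳ px≈0 ⟩
        0# + r * eval Q x               ≈⟨ +-identityˡ _ ⟩
        r * eval Q x                    ∎
      Q-roots : ∀ i → eval Q (root (Fin.suc i)) ≈ 0#
      Q-roots i with eval Q (root (Fin.suc i)) ≟ 0#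
      ... | yes Qx≈0 = Qx≈0
      ... | no  Qx≉0 with injective (Fin.suc i) Fin.zero (*-cancelʳ Qx≉0 (xQ≈rQ _ (roots (Fin.suc i))))
      ...   | ()

  vanishing⇒≈ₚ[] : ∀ p → length p ℕ.≤ q → (∀ x → eval p x ≈ 0#) → _≈ₚ_ F p []
  vanishing⇒≈ₚ[] p |p|≤q vanishes = distinctRoots⇒≈ₚ[] element (λ i j → element-injective) p |p|≤q (λ i → vanishes (element i))

  X^ : ℕ → Poly F
  X^ zero    = 1# ∷ []
  X^ (suc d) = 0# ∷ X^ d

  eval-X^ : ∀ d x → eval (X^ d) x ≈ x ^ d
  eval-X^ zero    x = trans (+-congˡ (zeroʳ x)) (+-identityʳ 1#)
  eval-X^ (suc d) x = trans (+-identityˡ _) (*-congˡ (eval-X^ d x))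

  length-X^ : ∀ d → length (X^ d) ≡ suc d
  length-X^ zero    = ≡.refl
  length-X^ (suc d) = ≡.cong suc (length-X^ d)

  coeff-X^-≡ : ∀ d → coeff F (X^ d) d ≡ 1#
  coeff-X^-≡ zero    = ≡.refl
  coeff-X^-≡ (suc d) = coeff-X^-≡ d

  coeff-X^-≢ : ∀ d i → i ≢ d → coeff F (X^ d) i ≈ 0#
  coeff-X^-≢ zero    zero    i≢d = ⊥-elim (i≢d ≡.refl)
  coeff-X^-≢ zero    (suc i) i≢d = refl
  coeff-X^-≢ (suc d) zero    i≢d = refl
  coeff-X^-≢ (suc d) (suc i) i≢d = coeff-X^-≢ d i (λ i≡d → i≢d (≡.cong suc i≡d))

  coeff-+ₚ : ∀ p r i → coeff F (_+ₚ_ F p r) i ≈ coeff F p i + coeff F r i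
  coeff-+ₚ []      r       i       = sym (+-identityˡ _)
  coeff-+ₚ (a ∷ p) []      i       = sym (+-identityʳ _)
  coeff-+ₚ (a ∷ p) (b ∷ r) zero    = refl
  coeff-+ₚ (a ∷ p) (b ∷ r) (suc i) = coeff-+ₚ p r i

  length-+ₚ : ∀ p r → length (_+ₚ_ F p r) ≡ length p ℕ.⊔ length r
  length-+ₚ []      r       = ≡.refl
  length-+ₚ (a ∷ p) []      = ≡.refl
  length-+ₚ (a ∷ p) (b ∷ r) = ≡.cong suc (length-+ₚ p r)

  coeff-≥length : ∀ p i → length p ℕ.≤ i → coeff F p i ≈ 0#
  coeff-≥length []      i       _           = refl
  coeff-≥length (a ∷ p) (suc i) (s≤s |p|≤i) = coeff-≥length p i |p|≤i

  binomial-root-bound : ∀ {N d d′} → d′ ℕ.< d → d ℕ.< N →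
                        (root : Fin N → Carrier) → (∀ i j → root i ≈ root j → i ≡ j) →
                        ¬ (∀ i → root i ^ d + root i ^ d′ ≈ 0#)
  binomial-root-bound {N} {d} {d′} d′<d d<N root injective roots = 1≉0 (begin
    1#                                       ≈⟨ +-identityʳ 1# ⟨
    1# + 0#                                  ≈⟨ +-cong (reflexive (coeff-X^-≡ d)) (coeff-X^-≢ d′ d (ℕₚ.>⇒≢ d′<d)) ⟨
    coeff F (X^ d) d + coeff F (X^ d′) d     ≈⟨ coeff-+ₚ (X^ d) (X^ d′) d ⟨
    coeff F binomial d                       ≈⟨ distinctRoots⇒≈ₚ[] root injective binomial |binomial|≤N binomial-roots d ⟩
    0#                                       ∎)
    where
      binomial = _+ₚ_ F (X^ d) (X^ d′)
      |binomial|≤N : length binomial ℕ.≤ N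
      |binomial|≤N rewrite length-+ₚ (X^ d) (X^ d′) | length-X^ d | length-X^ d′ =
        ℕₚ.⊔-lub d<N (ℕₚ.<-trans d′<d d<N)
      binomial-roots : ∀ i → eval binomial (root i) ≈ 0#
      binomial-roots i = trans (eval-+ₚ (X^ d) (X^ d′) (root i))
                               (trans (+-cong (eval-X^ d (root i)) (eval-X^ d′ (root i))) (roots i))

module Irreducibility {q : ℕ} (F : FiniteField q) where

  open FieldProperties F
  open Polynomials F

  HasDegree : Poly F → ℕ → Set
  HasDegree f d = coeff F f d ≉ 0# × (∀ j → d ℕ.< j → coeff F f j ≈ 0#)

  ≈ₚ[]⊎HasDegree : ∀ f → _≈ₚ_ F f [] ⊎ ∃ (HasDegree f)
  ≈ₚ[]⊎HasDegree [] = inj₁ (λ i → refl)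
  ≈ₚ[]⊎HasDegree (a ∷ f) with ≈ₚ[]⊎HasDegree f
  ... | inj₂ (d , fd≉0 , f>d≈0) = inj₂ (suc d , fd≉0 , λ { (suc j) (s≤s d<j) → f>d≈0 j d<j })
  ... | inj₁ f≈0 with a ≟ 0#
  ...   | yes a≈0 = inj₁ (λ { zero → a≈0 ; (suc i) → f≈0 i })
  ...   | no  a≉0 = inj₂ (0 , a≉0 , λ { (suc j) _ → f≈0 j })

  IsConstant⊎HasPositiveDegree : ∀ f → IsConstant F f ⊎ ∃ λ d → HasDegree f (suc d)
  IsConstant⊎HasPositiveDegree f with ≈ₚ[]⊎HasDegree f
  ... | inj₁ f≈0                     = inj₁ (λ i → f≈0 (suc i))
  ... | inj₂ (zero , _ , f>0≈0)      = inj₁ (λ i → f>0≈0 (suc i) (s≤s z≤n))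
  ... | inj₂ (suc d , f-has-degree) = inj₂ (d , f-has-degree)

  private
    coeff-*ₚ-∷ : ∀ a f g j → coeff F (_*ₚ_ F (a ∷ f) g) j ≈ a * coeff F g j + coeff F (0# ∷ _*ₚ_ F f g) j
    coeff-*ₚ-∷ a f g j = trans (coeff-+ₚ (map (a *_) g) (0# ∷ _*ₚ_ F f g) j) (+-congʳ (coeff-scale g j))
      where
        coeff-scale : ∀ g j → coeff F (map (a *_) g) j ≈ a * coeff F g j
        coeff-scale []      j       = sym (zeroʳ a)
        coeff-scale (b ∷ g) zero    = refl
        coeff-scale (b ∷ g) (suc j) = coeff-scale g j

    coeff-0∷ : ∀ h j → _≈ₚ_ F h [] → coeff F (0# ∷ h) j ≈ 0#
    coeff-0∷ h zero    h≈0 = refl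
    coeff-0∷ h (suc j) h≈0 = h≈0 j

    ≈ₚ[]-*ₚ : ∀ f g → _≈ₚ_ F f [] → _≈ₚ_ F (_*ₚ_ F f g) []
    ≈ₚ[]-*ₚ []      g f≈0 j = refl
    ≈ₚ[]-*ₚ (a ∷ f) g f≈0 j = trans (coeff-*ₚ-∷ a f g j) (trans
      (+-cong (trans (*-congʳ (f≈0 0)) (zeroˡ _)) (coeff-0∷ (_*ₚ_ F f g) j (≈ₚ[]-*ₚ f g (λ i → f≈0 (suc i)))))
      (+-identityʳ 0#))

  coeff-*ₚ-top : ∀ f g df dg → (∀ j → df ℕ.< j → coeff F f j ≈ 0#) → (∀ j → dg ℕ.< j → coeff F g j ≈ 0#) →
                 coeff F (_*ₚ_ F f g) (df ℕ.+ dg) ≈ coeff F f df * coeff F g dg ×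
                 (∀ j → df ℕ.+ dg ℕ.< j → coeff F (_*ₚ_ F f g) j ≈ 0#)
  coeff-*ₚ-top []      g df       dg f>df≈0 g>dg≈0 = sym (zeroˡ _) , λ j _ → refl
  coeff-*ₚ-top (a ∷ f) g zero     dg f>df≈0 g>dg≈0 = top , above
    where
      fg≈0 = ≈ₚ[]-*ₚ f g (λ i → f>df≈0 (suc i) (s≤s z≤n))
      top : coeff F (_*ₚ_ F (a ∷ f) g) dg ≈ a * coeff F g dg
      top = trans (coeff-*ₚ-∷ a f g dg) (trans (+-congˡ (coeff-0∷ (_*ₚ_ F f g) dg fg≈0)) (+-identityʳ _))
      above : ∀ j → dg ℕ.< j → coeff F (_*ₚ_ F (a ∷ f) g) j ≈ 0#
      above j dg<j = trans (coeff-*ₚ-∷ a f g j)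
        (trans (+-cong (trans (*-congˡ (g>dg≈0 j dg<j)) (zeroʳ a)) (coeff-0∷ (_*ₚ_ F f g) j fg≈0)) (+-identityʳ 0#))
  coeff-*ₚ-top (a ∷ f) g (suc df) dg f>df≈0 g>dg≈0 = top , above
    where
      ih = coeff-*ₚ-top f g df dg (λ j df<j → f>df≈0 (suc j) (s≤s df<j)) g>dg≈0
      top : coeff F (_*ₚ_ F (a ∷ f) g) (suc (df ℕ.+ dg)) ≈ coeff F f df * coeff F g dg
      top = trans (coeff-*ₚ-∷ a f g (suc (df ℕ.+ dg)))
        (trans (+-cong (trans (*-congˡ (g>dg≈0 _ (s≤s (ℕₚ.m≤n+m dg df)))) (zeroʳ a)) (proj₁ ih)) (+-identityˡ _))
      above : ∀ j → suc (df ℕ.+ dg) ℕ.< j → coeff F (_*ₚ_ F (a ∷ f) g) j ≈ 0#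
      above (suc j) (s≤s df+dg<j) = trans (coeff-*ₚ-∷ a f g (suc j))
        (trans (+-cong (trans (*-congˡ (g>dg≈0 _ (ℕₚ.≤-trans (s≤s (ℕₚ.m≤n+m dg df)) (ℕₚ.m≤n⇒m≤1+n df+dg<j)))) (zeroʳ a))
                       (proj₂ ih j df+dg<j))
               (+-identityʳ 0#))

  HasDegree-*ₚ : ∀ {f g a b} → HasDegree f a → HasDegree g b → HasDegree (_*ₚ_ F f g) (a ℕ.+ b)
  HasDegree-*ₚ {f} {g} {a} {b} (fa≉0 , f>a≈0) (gb≉0 , g>b≈0) =
    let (top , above) = coeff-*ₚ-top f g a b f>a≈0 g>b≈0
    in (λ top≈0 → *-≉0 fa≉0 gb≉0 (trans (sym top) top≈0)) , above

  HasDegree-≈ₚ : ∀ {f g d} → _≈ₚ_ F f g → HasDegree f d → HasDegree g d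
  HasDegree-≈ₚ f≈g (fd≉0 , f>d≈0) = (λ gd≈0 → fd≉0 (trans (f≈g _) gd≈0)) , λ j d<j → trans (sym (f≈g j)) (f>d≈0 j d<j)

  HasDegree-unique : ∀ {f d e} → HasDegree f d → HasDegree f e → d ≡ e
  HasDegree-unique {d = d} {e} (fd≉0 , f>d≈0) (fe≉0 , f>e≈0) with ℕₚ.<-cmp d e
  ... | tri< d<e _ _ = ⊥-elim (fe≉0 (f>d≈0 e d<e))
  ... | tri≈ _ d≡e _ = d≡e
  ... | tri> _ _ e<d = ⊥-elim (fd≉0 (f>e≈0 d e<d))

  linear⇒root : ∀ f → HasDegree f 1 → ∃ λ r → eval f r ≈ 0#
  linear⇒root f (b≉0 , f>1≈0) with proj₂ isField (coeff F f 1) b≉0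
  ... | b⁻¹ , bb⁻¹≈1 = r , (begin
    eval f r                  ≈⟨ eval-≈ₚ f (a ∷ b ∷ []) r f≈a+bX ⟩
    a + r * (b + r * 0#)      ≈⟨ +-congˡ (*-congˡ (trans (+-congˡ (zeroʳ r)) (+-identityʳ b))) ⟩
    a + r * b                 ≈⟨ +-congˡ (-‿distribˡ-* (a * b⁻¹) b) ⟨
    a + - ((a * b⁻¹) * b)     ≈⟨ +-congˡ (-‿cong (trans (*-assoc a b⁻¹ b) (trans (*-congˡ (trans (*-comm b⁻¹ b) bb⁻¹≈1)) (*-identityʳ a)))) ⟩
    a + - a                   ≈⟨ -‿inverseʳ a ⟩
    0#                        ∎)
    where
      a = coeff F f 0
      b = coeff F f 1
      r = - (a * b⁻¹)
      f≈a+bX : _≈ₚ_ F f (a ∷ b ∷ [])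
      f≈a+bX zero          = refl
      f≈a+bX (suc zero)    = refl
      f≈a+bX (suc (suc i)) = f>1≈0 (suc (suc i)) (s≤s (s≤s z≤n))

  -- a proper factorisation of a polynomial of degree at most 3 has a linear factor
  rootless⇒irreducible : ∀ p d → d ℕ.< 3 → HasDegree p (suc d) → (∀ r → eval p r ≉ 0#) → Irreducible F p
  rootless⇒irreducible p d d<3 p-degree rootless = (λ p-const → proj₁ p-degree (p-const d)) , factors
    where
      linear-factor : ∀ a b → suc a ℕ.+ suc b ≡ suc d → a ≡ 0 ⊎ b ≡ 0
      linear-factor zero    b       _      = inj₁ ≡.refl
      linear-factor (suc a) zero    _      = inj₂ ≡.refl
      linear-factor (suc a) (suc b) ≡.refl = ⊥-elim (ℕₚ.<⇒≱ d<3 (s≤s (ℕₚ.≤-trans (s≤s (s≤s z≤n)) (ℕₚ.m≤n+m (suc (suc b)) a))))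
      eval-factors : ∀ f g → _≈ₚ_ F p (_*ₚ_ F f g) → ∀ r → eval p r ≈ eval f r * eval g r
      eval-factors f g p≈fg r = trans (eval-≈ₚ p (_*ₚ_ F f g) r p≈fg) (eval-*ₚ f g r)
      factors : ∀ f g → _≈ₚ_ F p (_*ₚ_ F f g) → IsConstant F f ⊎ IsConstant F g
      factors f g p≈fg with IsConstant⊎HasPositiveDegree f | IsConstant⊎HasPositiveDegree g
      ... | inj₁ f-const | _            = inj₁ f-const
      ... | inj₂ _       | inj₁ g-const = inj₂ g-const
      ... | inj₂ (a , f-degree) | inj₂ (b , g-degree)
        with linear-factor a b (HasDegree-unique {_*ₚ_ F f g} (HasDegree-*ₚ {f} {g} f-degree g-degree)
                                                 (HasDegree-≈ₚ {p} {_*ₚ_ F f g} p≈fg p-degree))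
      ...   | inj₁ ≡.refl = let (r , fr≈0) = linear⇒root f f-degree
                            in ⊥-elim (rootless r (trans (eval-factors f g p≈fg r) (trans (*-congʳ fr≈0) (zeroˡ _))))
      ...   | inj₂ ≡.refl = let (r , gr≈0) = linear⇒root g g-degree
                            in ⊥-elim (rootless r (trans (eval-factors f g p≈fg r) (trans (*-congˡ gr≈0) (zeroʳ _))))

module Characteristic2 (m : ℕ) (F : FiniteField (2 ℕ.^ m)) where

  open FieldProperties F
  open Polynomials F
  open Irreducibility F
  open Sums F

  m≡1+ : ∃ λ m′ → m ≡ suc m′
  m≡1+ = positive m 1<q
    where
      positive : ∀ n → 1 ℕ.< 2 ℕ.^ n → ∃ λ n′ → n ≡ suc n′
      positive zero     (s≤s ())
      positive (suc n′) _ = n′ , ≡.refl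

  -- by Fermat, -1 = (-1)^(2^m) = ((-1)²)^(2^(m-1)) = 1
  1+1≈0 : 1# + 1# ≈ 0#
  1+1≈0 with m≡1+
  ... | m′ , ≡.refl = begin
    1# + 1#                          ≈⟨ +-congʳ (trans (sym (1^n≈1 (2 ℕ.^ m′))) (^-congˡ (2 ℕ.^ m′) (sym [-1]²≈1))) ⟩
    ((- 1#) ^ 2) ^ (2 ℕ.^ m′) + 1#   ≈⟨ +-congʳ (^-assocʳ (- 1#) 2 (2 ℕ.^ m′)) ⟩
    (- 1#) ^ (2 ℕ.^ m) + 1#          ≈⟨ +-congʳ (x^q≈x (- 1#)) ⟩
    - 1# + 1#                        ≈⟨ -‿inverseˡ 1# ⟩
    0#                               ∎
    where
      [-1]²≈1 : (- 1#) ^ 2 ≈ 1#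
      [-1]²≈1 = trans (*-congˡ (*-identityʳ (- 1#))) (trans (-1*x≈-x (- 1#)) (-‿involutive 1#))

  x+x≈0 : ∀ x → x + x ≈ 0#
  x+x≈0 x = begin
    x + x           ≈⟨ solve 1 (λ x → x :+ x := (con 1 :+ con 1) :* x) refl x ⟩
    (1# + 1#) * x   ≈⟨ *-congʳ 1+1≈0 ⟩
    0# * x          ≈⟨ zeroˡ x ⟩
    0#              ∎

  x+y≈0⇒x≈y : ∀ {x y} → x + y ≈ 0# → x ≈ y
  x+y≈0⇒x≈y {x} {y} x+y≈0 = begin
    x              ≈⟨ +-identityʳ x ⟨
    x + 0#         ≈⟨ +-congˡ (x+x≈0 y) ⟨
    x + (y + y)    ≈⟨ +-assoc x y y ⟨
    (x + y) + y    ≈⟨ +-congʳ x+y≈0 ⟩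
    0# + y         ≈⟨ +-identityˡ y ⟩
    y              ∎

  1+[1+x]≈x : ∀ x → 1# + (1# + x) ≈ x
  1+[1+x]≈x x = trans (sym (+-assoc 1# 1# x)) (trans (+-congʳ 1+1≈0) (+-identityˡ x))

  x≈a+y⇒y≈a+x : ∀ {a x y} → x ≈ a + y → y ≈ a + x
  x≈a+y⇒y≈a+x {a} {x} {y} x≈a+y = begin
    y              ≈⟨ +-identityˡ y ⟨
    0# + y         ≈⟨ +-congʳ (x+x≈0 a) ⟨
    (a + a) + y    ≈⟨ +-assoc a a y ⟩
    a + (a + y)    ≈⟨ +-congˡ x≈a+y ⟨
    a + x          ∎

  x≈y⇒x+y≈0 : ∀ {x y} → x ≈ y → x + y ≈ 0#
  x≈y⇒x+y≈0 {x} {y} x≈y = trans (+-congʳ x≈y) (x+x≈0 y)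

  x*x≈x⇒x≈0∨x≈1 : ∀ {x} → x * x ≈ x → x ≈ 0# ⊎ x ≈ 1#
  x*x≈x⇒x≈0∨x≈1 {x} x*x≈x with x*y≈0⇒x≈0∨y≈0 (trans (distribˡ x x 1#) (x≈y⇒x+y≈0 (trans x*x≈x (sym (*-identityʳ x)))))
  ... | inj₁ x≈0   = inj₁ x≈0
  ... | inj₂ x+1≈0 = inj₂ (x+y≈0⇒x≈y x+1≈0)

  +-cancelˡ : ∀ a {x y} → a + x ≈ a + y → x ≈ y
  +-cancelˡ a {x} {y} a+x≈a+y = x+y≈0⇒x≈y (begin
    x + y                ≈⟨ +-identityˡ _ ⟨
    0# + (x + y)         ≈⟨ +-congʳ (x+x≈0 a) ⟨
    (a + a) + (x + y)    ≈⟨ solve 3 (λ a x y → (a :+ a) :+ (x :+ y) := (a :+ x) :+ (a :+ y)) refl a x y ⟩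
    (a + x) + (a + y)    ≈⟨ x≈y⇒x+y≈0 a+x≈a+y ⟩
    0#                   ∎)

  [x+y]²≈x²+y² : ∀ x y → (x + y) * (x + y) ≈ x * x + y * y
  [x+y]²≈x²+y² x y = begin
    (x + y) * (x + y)                  ≈⟨ solve 2 (λ x y → (x :+ y) :* (x :+ y) := (x :* x :+ y :* y) :+ (x :* y :+ x :* y)) refl x y ⟩
    (x * x + y * y) + (x * y + x * y)  ≈⟨ +-congˡ (x+x≈0 _) ⟩
    (x * x + y * y) + 0#               ≈⟨ +-identityʳ _ ⟩
    x * x + y * y                      ∎

  x^2^[1+i]≈[x^2^i]² : ∀ x i → x ^ (2 ℕ.^ suc i) ≈ x ^ (2 ℕ.^ i) * x ^ (2 ℕ.^ i)
  x^2^[1+i]≈[x^2^i]² x i = begin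
    x ^ (2 ℕ.^ i ℕ.+ (2 ℕ.^ i ℕ.+ 0))   ≈⟨ ^-homo-* x (2 ℕ.^ i) _ ⟩
    x ^ (2 ℕ.^ i) * x ^ (2 ℕ.^ i ℕ.+ 0) ≈⟨ *-congˡ (^-congʳ x (ℕₚ.+-identityʳ (2 ℕ.^ i))) ⟩
    x ^ (2 ℕ.^ i) * x ^ (2 ℕ.^ i)       ∎

  [x*x]^2^i≈x^2^[1+i] : ∀ x i → (x * x) ^ (2 ℕ.^ i) ≈ x ^ (2 ℕ.^ suc i)
  [x*x]^2^i≈x^2^[1+i] x i = begin
    (x * x) ^ (2 ℕ.^ i)               ≈⟨ ^-distrib-* x x (2 ℕ.^ i) ⟩
    x ^ (2 ℕ.^ i) * x ^ (2 ℕ.^ i)     ≈⟨ x^2^[1+i]≈[x^2^i]² x i ⟨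
    x ^ (2 ℕ.^ suc i)                 ∎

  frobenius-+ : ∀ i x y → (x + y) ^ (2 ℕ.^ i) ≈ x ^ (2 ℕ.^ i) + y ^ (2 ℕ.^ i)
  frobenius-+ zero    x y = trans (*-identityʳ _) (sym (+-cong (*-identityʳ x) (*-identityʳ y)))
  frobenius-+ (suc i) x y = begin
    (x + y) ^ (2 ℕ.^ suc i)                                   ≈⟨ x^2^[1+i]≈[x^2^i]² (x + y) i ⟩
    (x + y) ^ (2 ℕ.^ i) * (x + y) ^ (2 ℕ.^ i)                 ≈⟨ *-cong (frobenius-+ i x y) (frobenius-+ i x y) ⟩
    (x ^ (2 ℕ.^ i) + y ^ (2 ℕ.^ i)) * (x ^ (2 ℕ.^ i) + y ^ (2 ℕ.^ i))
                                                              ≈⟨ [x+y]²≈x²+y² _ _ ⟩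
    x ^ (2 ℕ.^ i) * x ^ (2 ℕ.^ i) + y ^ (2 ℕ.^ i) * y ^ (2 ℕ.^ i)
                                                              ≈⟨ +-cong (x^2^[1+i]≈[x^2^i]² x i) (x^2^[1+i]≈[x^2^i]² y i) ⟨
    x ^ (2 ℕ.^ suc i) + y ^ (2 ℕ.^ suc i)                     ∎

  0^2^i≈0 : ∀ i → 0# ^ (2 ℕ.^ i) ≈ 0#
  0^2^i≈0 zero    = zeroˡ _
  0^2^i≈0 (suc i) = trans (x^2^[1+i]≈[x^2^i]² 0# i) (trans (*-congˡ (0^2^i≈0 i)) (zeroʳ _))

  ∑-square : ∀ k f → ∑< k f * ∑< k f ≈ ∑[ i < k ] (f i * f i)
  ∑-square zero    f = zeroˡ 0#
  ∑-square (suc k) f = trans ([x+y]²≈x²+y² _ _) (+-congˡ (∑-square k (λ i → f (suc i))))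

  ∑[i<k]1-parity : ∀ k → (k ℕ.% 2 ≡ 0 × ∑[ i < k ] 1# ≈ 0#) ⊎ (k ℕ.% 2 ≡ 1 × ∑[ i < k ] 1# ≈ 1#)
  ∑[i<k]1-parity zero          = inj₁ (≡.refl , refl)
  ∑[i<k]1-parity (suc zero)    = inj₂ (≡.refl , +-identityʳ 1#)
  ∑[i<k]1-parity (suc (suc k)) with ∑[i<k]1-parity k
  ... | inj₁ (k%2≡0 , ∑≈0) = inj₁ (k%2≡0 , trans (1+[1+x]≈x _) ∑≈0)
  ... | inj₂ (k%2≡1 , ∑≈1) = inj₂ (k%2≡1 , trans (1+[1+x]≈x _) ∑≈1)

  trace : ℕ → Carrier → Carrier
  trace d x = ∑[ i < d ] x ^ (2 ℕ.^ i)

  Tr : Carrier → Carrier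
  Tr = trace m

  trace-cong : ∀ d {x y} → x ≈ y → trace d x ≈ trace d y
  trace-cong d x≈y = ∑-cong d (λ i → ^-congˡ (2 ℕ.^ i) x≈y)

  trace-+ : ∀ d x y → trace d (x + y) ≈ trace d x + trace d y
  trace-+ d x y = trans (∑-cong d (λ i → frobenius-+ i x y)) (∑-+ d _ _)

  trace-0 : ∀ d → trace d 0# ≈ 0#
  trace-0 d = trans (∑-cong d 0^2^i≈0) (∑-0 d)

  trace-1 : ∀ d → trace d 1# ≈ ∑[ i < d ] 1#
  trace-1 d = ∑-cong d (λ i → 1^n≈1 (2 ℕ.^ i))

  trace-square : ∀ d x → trace d x * trace d x ≈ trace d (x * x)
  trace-square d x = trans (∑-square d _) (∑-cong d (λ i → trans (sym (x^2^[1+i]≈[x^2^i]² x i)) (sym ([x*x]^2^i≈x^2^[1+i] x i))))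

  trace-suc : ∀ d x → trace (suc d) x ≈ x + trace d (x * x)
  trace-suc d x = +-cong (*-identityʳ x) (∑-cong d (λ i → sym ([x*x]^2^i≈x^2^[1+i] x i)))

  Tr-square : ∀ x → Tr (x * x) ≈ Tr x
  Tr-square x = +-cancelˡ x (begin
    x + Tr (x * x)          ≈⟨ trace-suc m x ⟨
    trace (suc m) x         ≈⟨ ∑-last m _ ⟩
    Tr x + x ^ (2 ℕ.^ m)    ≈⟨ +-congˡ (x^q≈x x) ⟩
    Tr x + x                ≈⟨ +-comm _ x ⟩
    x + Tr x                ∎)

  Tr[x*x+x]≈0 : ∀ x → Tr (x * x + x) ≈ 0#
  Tr[x*x+x]≈0 x = trans (trace-+ m (x * x) x) (x≈y⇒x+y≈0 (Tr-square x))

  Tr≈0∨Tr≈1 : ∀ x → Tr x ≈ 0# ⊎ Tr x ≈ 1#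
  Tr≈0∨Tr≈1 x = x*x≈x⇒x≈0∨x≈1 (trans (trace-square m x) (Tr-square x))

  normalBasis⇒Tr≉0 : ∀ {α} → IsNormalBasis F m α → Tr α ≉ 0#
  normalBasis⇒Tr≉0 {α} (independent , _) Trα≈0 =
    let (m′ , m≡1+m′) = m≡1+
    in true≢false (independent (λ _ → true) ∑basis≈0 (≡.subst Fin (≡.sym m≡1+m′) Fin.zero))
    where
      true≢false : true ≢ false
      true≢false ()
      ∑basis≈0 : sum F {m} (λ i → pow F α (2 ℕ.^ toℕ i)) ≈ 0#
      ∑basis≈0 = begin
        sum F {m} (λ i → pow F α (2 ℕ.^ toℕ i))   ≈⟨ sum≈∑ m (λ i → α ^ (2 ℕ.^ i)) (λ i → reflexive (pow≡^ α (2 ℕ.^ toℕ i))) ⟩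
        Tr α                                  ≈⟨ Trα≈0 ⟩
        0#                                    ∎

  trace-transitive : ∀ j n x → trace (j ℕ.* n) x ≈ trace n (∑[ l < j ] x ^ ((2 ℕ.^ n) ℕ.^ l))
  trace-transitive zero    n x = sym (trace-0 n)
  trace-transitive (suc j) n x = begin
    trace (n ℕ.+ j ℕ.* n) x                                     ≈⟨ ∑-split n (j ℕ.* n) _ ⟩
    trace n x + ∑[ i < j ℕ.* n ] x ^ (2 ℕ.^ (n ℕ.+ i))          ≈⟨ +-congˡ (∑-cong (j ℕ.* n) x^2^[n+i]≈[x^q]^2^i) ⟩
    trace n x + trace (j ℕ.* n) (x ^ q)                         ≈⟨ +-congˡ (trace-transitive j n (x ^ q)) ⟩
    trace n x + trace n (∑[ l < j ] (x ^ q) ^ (q ℕ.^ l))        ≈⟨ trace-+ n _ _ ⟨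
    trace n (x + ∑[ l < j ] (x ^ q) ^ (q ℕ.^ l))                ≈⟨ trace-cong n (+-cong (sym (*-identityʳ x)) (∑-cong j (λ l → ^-assocʳ x q (q ℕ.^ l)))) ⟩
    trace n (∑[ l < suc j ] x ^ (q ℕ.^ l))                      ∎
    where
      q = 2 ℕ.^ n
      x^2^[n+i]≈[x^q]^2^i : ∀ i → x ^ (2 ℕ.^ (n ℕ.+ i)) ≈ (x ^ q) ^ (2 ℕ.^ i)
      x^2^[n+i]≈[x^q]^2^i i = trans (^-congʳ x (ℕₚ.^-distribˡ-+-* 2 n i)) (sym (^-assocʳ x q (2 ℕ.^ i)))

  tracePoly : ℕ → Poly F
  tracePoly zero    = []
  tracePoly (suc d) = _+ₚ_ F (X^ (2 ℕ.^ d)) (tracePoly d)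

  eval-tracePoly : ∀ d x → eval (tracePoly d) x ≈ trace d x
  eval-tracePoly zero    x = refl
  eval-tracePoly (suc d) x = begin
    eval (tracePoly (suc d)) x                    ≈⟨ eval-+ₚ (X^ (2 ℕ.^ d)) (tracePoly d) x ⟩
    eval (X^ (2 ℕ.^ d)) x + eval (tracePoly d) x  ≈⟨ +-cong (eval-X^ (2 ℕ.^ d) x) (eval-tracePoly d x) ⟩
    x ^ (2 ℕ.^ d) + trace d x                     ≈⟨ +-comm _ _ ⟩
    trace d x + x ^ (2 ℕ.^ d)                     ≈⟨ ∑-last d _ ⟨
    trace (suc d) x                               ∎

  length-tracePoly : ∀ d → length (tracePoly d) ℕ.≤ 2 ℕ.^ d
  length-tracePoly zero    = z≤n
  length-tracePoly (suc d) rewrite length-+ₚ (X^ (2 ℕ.^ d)) (tracePoly d) | length-X^ (2 ℕ.^ d) =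
    ℕₚ.⊔-lub (ℕₚ.+-mono-≤ (ℕₚ.m^n>0 2 d) (ℕₚ.m≤m+n (2 ℕ.^ d) 0))
             (ℕₚ.≤-trans (length-tracePoly d) (ℕₚ.m≤m+n _ _))

  -- Tr is a nonzero polynomial function of degree 2^(m-1) < q
  ∃Tr≈1 : ∃ λ θ → Tr θ ≈ 1#
  ∃Tr≈1 with ¬∀⇒∃¬ (λ x → Tr x ≈ 0#) (λ x → Tr x ≟ 0#) (λ x≈y Trx≈0 → trans (trace-cong m (sym x≈y)) Trx≈0) Tr≉0
    where
      Tr≉0 : ¬ (∀ x → Tr x ≈ 0#)
      Tr≉0 Tr≈0 with m≡1+
      ... | m′ , ≡.refl = 1≉0 (begin
        1#                                                  ≈⟨ +-identityʳ 1# ⟨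
        1# + 0#                                             ≈⟨ +-cong (reflexive (coeff-X^-≡ (2 ℕ.^ m′))) (coeff-≥length (tracePoly m′) _ (length-tracePoly m′)) ⟨
        coeff F (X^ d) d + coeff F (tracePoly m′) d         ≈⟨ coeff-+ₚ (X^ d) (tracePoly m′) d ⟨
        coeff F (tracePoly m) d                             ≈⟨ vanishing⇒≈ₚ[] (tracePoly m) (length-tracePoly m) (λ x → trans (eval-tracePoly m x) (Tr≈0 x)) d ⟩
        0#                                                  ∎)
        where d = 2 ℕ.^ m′
  ... | θ , Trθ≉0 with Tr≈0∨Tr≈1 θ
  ...   | inj₁ Trθ≈0 = ⊥-elim (Trθ≉0 Trθ≈0)
  ...   | inj₂ Trθ≈1 = θ , Trθ≈1

  -- x = Σ_{i<m} (y + y² + ... + y^(2^(i-1))) θ^(2^i), for any θ with Tr θ = 1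
  artin-schreier : ∀ {y} → Tr y ≈ 0# → ∃ λ x → x * x + x ≈ y
  artin-schreier {y} Try≈0 = x , (begin
    x * x + x         ≈⟨ +-congʳ x*x≈y+x ⟩
    (y + x) + x       ≈⟨ +-assoc y x x ⟩
    y + (x + x)       ≈⟨ +-congˡ (x+x≈0 x) ⟩
    y + 0#            ≈⟨ +-identityʳ y ⟩
    y                 ∎)
    where
      θ = proj₁ ∃Tr≈1
      S : ℕ → Carrier
      S i = trace i y
      g : ℕ → Carrier
      g i = S i * θ ^ (2 ℕ.^ i)
      x = ∑< m g
      ∑g∘suc≈x : ∑[ i < m ] g (suc i) ≈ x
      ∑g∘suc≈x = begin
        ∑[ i < m ] g (suc i)           ≈⟨ +-identityˡ _ ⟨
        0# + ∑[ i < m ] g (suc i)      ≈⟨ +-congʳ (zeroˡ _) ⟨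
        ∑< (suc m) g                   ≈⟨ ∑-last m g ⟩
        x + S m * θ ^ (2 ℕ.^ m)        ≈⟨ +-congˡ (trans (*-congʳ Try≈0) (zeroˡ _)) ⟩
        x + 0#                         ≈⟨ +-identityʳ x ⟩
        x                              ∎
      Sᵢ²≈y+Sᵢ₊₁ : ∀ i → S i * S i ≈ y + S (suc i)
      Sᵢ²≈y+Sᵢ₊₁ i = x≈a+y⇒y≈a+x (trans (trace-suc i y) (+-congˡ (sym (trace-square i y))))
      x*x≈y+x : x * x ≈ y + x
      x*x≈y+x = begin
        x * x                                                      ≈⟨ ∑-square m g ⟩
        ∑[ i < m ] (S i * θ ^ (2 ℕ.^ i)) * (S i * θ ^ (2 ℕ.^ i))   ≈⟨ ∑-cong m (λ i → solve 2 (λ s t → (s :* t) :* (s :* t) := (s :* s) :* (t :* t)) refl (S i) _) ⟩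
        ∑[ i < m ] (S i * S i) * (θ ^ (2 ℕ.^ i) * θ ^ (2 ℕ.^ i))   ≈⟨ ∑-cong m (λ i → *-cong (Sᵢ²≈y+Sᵢ₊₁ i) (sym (x^2^[1+i]≈[x^2^i]² θ i))) ⟩
        ∑[ i < m ] (y + S (suc i)) * θ ^ (2 ℕ.^ suc i)             ≈⟨ ∑-cong m (λ i → distribʳ _ y (S (suc i))) ⟩
        ∑[ i < m ] (y * θ ^ (2 ℕ.^ suc i) + g (suc i))             ≈⟨ ∑-+ m _ _ ⟩
        ∑[ i < m ] y * θ ^ (2 ℕ.^ suc i) + ∑[ i < m ] g (suc i)    ≈⟨ +-cong (∑-*ˡ m y _) ∑g∘suc≈x ⟩
        y * (∑[ i < m ] θ ^ (2 ℕ.^ suc i)) + x                     ≈⟨ +-congʳ (*-congˡ (∑-cong m (λ i → [x*x]^2^i≈x^2^[1+i] θ i))) ⟨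
        y * Tr (θ * θ) + x                                         ≈⟨ +-congʳ (*-congˡ (trans (Tr-square θ) (proj₂ ∃Tr≈1))) ⟩
        y * 1# + x                                                 ≈⟨ +-congʳ (*-identityʳ y) ⟩
        y + x                                                      ∎

  eval-quadPoly : ∀ β r → eval (quadPoly F β) r ≈ (r * r + r) + β
  eval-quadPoly β r = begin
    β + r * (1# + r * (1# + r * 0#))   ≈⟨ solve 2 (λ b r → b :+ r :* (con 1 :+ r :* (con 1 :+ r :* con 0)) := (r :* r :+ r) :+ b) refl β r ⟩
    (r * r + r) + β                    ∎

  eval-cubePoly : ∀ β r → eval (cubePoly F β) r ≈ r ^ 3 + β
  eval-cubePoly β r = begin
    β + r * (0# + r * (0# + r * (1# + r * 0#)))
      ≈⟨ solve 2 (λ b r → b :+ r :* (con 0 :+ r :* (con 0 :+ r :* (con 1 :+ r :* con 0))) := r :* (r :* (r :* con 1)) :+ b) refl β r ⟩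
    r ^ 3 + β                                     ∎

  quadPoly-irreducible⇔ : ∀ β → Irreducible F (quadPoly F β) ⇔ (∀ r → r * r + r ≉ β)
  quadPoly-irreducible⇔ β = mk⇔ rootless irreducible
    where
      rootless : Irreducible F (quadPoly F β) → ∀ r → r * r + r ≉ β
      rootless (_ , factors) r r²+r≈β with factors (r ∷ 1# ∷ []) ((r + 1#) ∷ 1# ∷ []) [X+r][X+r+1]
        where
          [X+r][X+r+1] : _≈ₚ_ F (quadPoly F β) (_*ₚ_ F (r ∷ 1# ∷ []) ((r + 1#) ∷ 1# ∷ []))
          [X+r][X+r+1] zero                = sym (trans (+-identityʳ _) (trans (trans (distribˡ r r 1#) (+-congˡ (*-identityʳ r))) r²+r≈β))
          [X+r][X+r+1] (suc zero)          = sym (begin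
            r * 1# + (1# * (r + 1#) + 0#)  ≈⟨ solve 1 (λ r → r :* con 1 :+ (con 1 :* (r :+ con 1) :+ con 0) := con 1 :+ (r :+ r)) refl r ⟩
            1# + (r + r)                   ≈⟨ +-congˡ (x+x≈0 r) ⟩
            1# + 0#                        ≈⟨ +-identityʳ 1# ⟩
            1#                             ∎)
          [X+r][X+r+1] (suc (suc zero))    = sym (*-identityˡ 1#)
          [X+r][X+r+1] (suc (suc (suc i))) = refl
      ... | inj₁ const = 1≉0 (const 0)
      ... | inj₂ const = 1≉0 (const 0)
      irreducible : (∀ r → r * r + r ≉ β) → Irreducible F (quadPoly F β)
      irreducible no-root = rootless⇒irreducible (quadPoly F β) 1 (s≤s (s≤s z≤n)) (1≉0 , above)
        (λ r root → no-root r (x+y≈0⇒x≈y (trans (sym (eval-quadPoly β r)) root)))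
        where
          above : ∀ j → 2 ℕ.< j → coeff F (quadPoly F β) j ≈ 0#
          above 0                   ()
          above 1                   (s≤s ())
          above 2                   (s≤s (s≤s ()))
          above (suc (suc (suc j))) _ = refl

  cubePoly-irreducible⇔ : ∀ β → Irreducible F (cubePoly F β) ⇔ (∀ r → r ^ 3 ≉ β)
  cubePoly-irreducible⇔ β = mk⇔ rootless irreducible
    where
      rootless : Irreducible F (cubePoly F β) → ∀ r → r ^ 3 ≉ β
      rootless (_ , factors) r r³≈β with factors (r ∷ 1# ∷ []) ((r * r) ∷ r ∷ 1# ∷ []) [X+r][X²+rX+r²]
        where
          [X+r][X²+rX+r²] : _≈ₚ_ F (cubePoly F β) (_*ₚ_ F (r ∷ 1# ∷ []) ((r * r) ∷ r ∷ 1# ∷ []))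
          [X+r][X²+rX+r²] zero                      = sym (trans (+-identityʳ _) (trans (*-congˡ (*-congˡ (sym (*-identityʳ r)))) r³≈β))
          [X+r][X²+rX+r²] (suc zero)                = sym (trans (+-congˡ (trans (+-identityʳ _) (*-identityˡ _))) (x+x≈0 _))
          [X+r][X²+rX+r²] (suc (suc zero))          = sym (trans (+-congˡ (trans (*-identityˡ r) (sym (*-identityʳ r)))) (x+x≈0 _))
          [X+r][X²+rX+r²] (suc (suc (suc zero)))    = sym (*-identityˡ 1#)
          [X+r][X²+rX+r²] (suc (suc (suc (suc i)))) = refl
      ... | inj₁ const = 1≉0 (const 0)
      ... | inj₂ const = 1≉0 (const 1)
      irreducible : (∀ r → r ^ 3 ≉ β) → Irreducible F (cubePoly F β)
      irreducible no-root = rootless⇒irreducible (cubePoly F β) 2 (s≤s (s≤s (s≤s z≤n))) (1≉0 , above)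
        (λ r root → no-root r (x+y≈0⇒x≈y (trans (sym (eval-cubePoly β r)) root)))
        where
          above : ∀ j → 3 ℕ.< j → coeff F (cubePoly F β) j ≈ 0#
          above 0                         ()
          above 1                         (s≤s ())
          above 2                         (s≤s (s≤s ()))
          above 3                         (s≤s (s≤s (s≤s ())))
          above (suc (suc (suc (suc j)))) _ = refl

  1+ω+ω²≈0 : ∀ {ω} → ω ^ 3 ≈ 1# → ω ≉ 1# → 1# + (ω + ω * ω) ≈ 0#
  1+ω+ω²≈0 {ω} ω³≈1 ω≉1 with x*y≈0⇒x≈0∨y≈0 [ω+1][1+ω+ω²]≈0
    where
      [ω+1][1+ω+ω²]≈0 : (ω + 1#) * (1# + (ω + ω * ω)) ≈ 0#
      [ω+1][1+ω+ω²]≈0 = begin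
        (ω + 1#) * (1# + (ω + ω * ω))
          ≈⟨ solve 1 (λ w → (w :+ con 1) :* (con 1 :+ (w :+ w :* w))
                         := (w :* (w :* (w :* con 1)) :+ con 1) :+ ((w :+ w) :+ (w :* w :+ w :* w))) refl ω ⟩
        (ω ^ 3 + 1#) + ((ω + ω) + (ω * ω + ω * ω))         ≈⟨ +-cong (x≈y⇒x+y≈0 ω³≈1) (trans (+-cong (x+x≈0 ω) (x+x≈0 _)) (+-identityʳ 0#)) ⟩
        0# + 0#                                            ≈⟨ +-identityʳ 0# ⟩
        0#                                                 ∎
  ... | inj₁ ω+1≈0       = ⊥-elim (ω≉1 (x+y≈0⇒x≈y ω+1≈0))
  ... | inj₂ sum≈0       = sum≈0

  cubeRootOfUnity-cases : ∀ {ω} → ω ^ 3 ≈ 1# → ω ≉ 1# → ∀ {v} → v ^ 3 ≈ 1# → v ≈ 1# ⊎ v ≈ ω ⊎ v ≈ ω * ω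
  cubeRootOfUnity-cases {ω} ω³≈1 ω≉1 {v} v³≈1 with x*y≈0⇒x≈0∨y≈0 [v+1][v+ω][v+ω²]≈0
    where
      [v+1][v+ω][v+ω²]≈0 : (v + 1#) * ((v + ω) * (v + ω * ω)) ≈ 0#
      [v+1][v+ω][v+ω²]≈0 = begin
        (v + 1#) * ((v + ω) * (v + ω * ω))
          ≈⟨ solve 2 (λ v w → (v :+ con 1) :* ((v :+ w) :* (v :+ w :* w))
                           := (v :* (v :* (v :* con 1)) :+ w :* (w :* (w :* con 1))) :+ (v :* v :+ v :* w) :* (con 1 :+ (w :+ w :* w)))
                     refl v ω ⟩
        (v ^ 3 + ω ^ 3) + (v * v + v * ω) * (1# + (ω + ω * ω))            ≈⟨ +-cong (x≈y⇒x+y≈0 (trans v³≈1 (sym ω³≈1))) (trans (*-congˡ (1+ω+ω²≈0 ω³≈1 ω≉1)) (zeroʳ _)) ⟩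
        0# + 0#                                                           ≈⟨ +-identityʳ 0# ⟩
        0#                                                                ∎
  ... | inj₁ v+1≈0 = inj₁ (x+y≈0⇒x≈y v+1≈0)
  ... | inj₂ rest with x*y≈0⇒x≈0∨y≈0 rest
  ...   | inj₁ v+ω≈0  = inj₂ (inj₁ (x+y≈0⇒x≈y v+ω≈0))
  ...   | inj₂ v+ω²≈0 = inj₂ (inj₂ (x+y≈0⇒x≈y v+ω²≈0))

  module CubeCriterion {e : ℕ} (q≡1+3e : 2 ℕ.^ m ≡ suc (e ℕ.* 3)) where

    e≡1+ : ∃ λ e′ → e ≡ suc e′
    e≡1+ = positive e q≡1+3e
      where
        positive : ∀ k → 2 ℕ.^ m ≡ suc (k ℕ.* 3) → ∃ λ k′ → k ≡ suc k′
        positive zero     q≡1 = ⊥-elim (ℕₚ.<-irrefl (≡.sym q≡1) 1<q)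
        positive (suc k′) _   = k′ , ≡.refl

    cube^e≈1 : ∀ {y} → y ≉ 0# → (y ^ 3) ^ e ≈ 1#
    cube^e≈1 {y} y≉0 = trans (^-assocʳ y 3 e) (trans (^-congʳ y (ℕₚ.*-comm 3 e)) (fermat-little q≡1+3e y≉0))

    -- the quotient of X^(3e) + x^e by X³ + x
    geometric : Carrier → ℕ → Poly F
    geometric x zero    = []
    geometric x (suc e) = x ^ e ∷ 0# ∷ 0# ∷ geometric x e

    length-geometric : ∀ x e → length (geometric x e) ≡ e ℕ.* 3
    length-geometric x zero    = ≡.refl
    length-geometric x (suc e) = ≡.cong (λ l → suc (suc (suc l))) (length-geometric x e)

    eval-geometric : ∀ x a e → (a ^ 3 + x) * eval (geometric x e) a ≈ (a ^ 3) ^ e + x ^ e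
    eval-geometric x a zero    = trans (zeroʳ _) (sym (x+x≈0 1#))
    eval-geometric x a (suc e) = begin
      (c + x) * (X + a * (0# + a * (0# + a * G)))   ≈⟨ *-congˡ (+-congˡ (solve 2 (λ a G → a :* (con 0 :+ a :* (con 0 :+ a :* G)) := (a :* (a :* (a :* con 1))) :* G) refl a G)) ⟩
      (c + x) * (X + c * G)                         ≈⟨ solve 4 (λ c x X G → (c :+ x) :* (X :+ c :* G) := (c :* X :+ x :* X) :+ c :* ((c :+ x) :* G)) refl c x X G ⟩
      (c * X + x * X) + c * ((c + x) * G)           ≈⟨ +-congˡ (*-congˡ (eval-geometric x a e)) ⟩
      (c * X + x * X) + c * (c ^ e + X)             ≈⟨ solve 4 (λ c x X Y → (c :* X :+ x :* X) :+ c :* (Y :+ X) := (c :* Y :+ x :* X) :+ (c :* X :+ c :* X)) refl c x X (c ^ e) ⟩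
      (c * c ^ e + x * X) + (c * X + c * X)         ≈⟨ +-congˡ (x+x≈0 _) ⟩
      (c * c ^ e + x * X) + 0#                      ≈⟨ +-identityʳ _ ⟩
      c ^ suc e + x ^ suc e                         ∎
      where
        c = a ^ 3
        X = x ^ e
        G = eval (geometric x e) a

    a*[a³]^e≈a : ∀ a → a * (a ^ 3) ^ e ≈ a
    a*[a³]^e≈a a = begin
      a * (a ^ 3) ^ e        ≈⟨ *-congˡ (trans (^-assocʳ a 3 e) (^-congʳ a (ℕₚ.*-comm 3 e))) ⟩
      a ^ suc (e ℕ.* 3)      ≈⟨ ^-congʳ a q≡1+3e ⟨
      a ^ (2 ℕ.^ m)          ≈⟨ x^q≈x a ⟩
      a                      ∎

    x^e≈1⇒cube : ∀ {x} → x ≉ 0# → x ^ e ≈ 1# → ∃ λ a → a ^ 3 ≈ x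
    x^e≈1⇒cube {x} x≉0 xᵉ≈1 =
      ¬∀¬⇒∃ (λ a → a ^ 3 ≈ x) (λ a → a ^ 3 ≟ x) (λ a≈b a³≈x → trans (^-congˡ 3 (sym a≈b)) a³≈x) has-cube-root
      where
        -- otherwise X · geometric x e, of degree q - 1, would vanish on all of F
        has-cube-root : ¬ (∀ a → a ^ 3 ≉ x)
        has-cube-root no-root =
          let (e′ , e≡1+e′) = e≡1+
          in ^-≉0 e′ x≉0 (≡.subst (λ k → coeff F (0# ∷ geometric x k) 1 ≈ 0#) e≡1+e′ (vanishing⇒≈ₚ[] P |P|≤q P-vanishes 1))
          where
            G = geometric x e
            P = 0# ∷ G
            |P|≤q : length P ℕ.≤ 2 ℕ.^ m
            |P|≤q = ℕₚ.≤-reflexive (≡.trans (≡.cong suc (length-geometric x e)) (≡.sym q≡1+3e))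
            P-vanishes : ∀ a → eval P a ≈ 0#
            P-vanishes a with x*y≈0⇒x≈0∨y≈0 [a³+x]aG≈0
              where
                [a³+x]aG≈0 : (a ^ 3 + x) * (a * eval G a) ≈ 0#
                [a³+x]aG≈0 = begin
                  (a ^ 3 + x) * (a * eval G a)     ≈⟨ solve 3 (λ u a g → u :* (a :* g) := a :* (u :* g)) refl (a ^ 3 + x) a (eval G a) ⟩
                  a * ((a ^ 3 + x) * eval G a)     ≈⟨ *-congˡ (eval-geometric x a e) ⟩
                  a * ((a ^ 3) ^ e + x ^ e)        ≈⟨ distribˡ a _ _ ⟩
                  a * (a ^ 3) ^ e + a * x ^ e      ≈⟨ +-cong (a*[a³]^e≈a a) (trans (*-congˡ xᵉ≈1) (*-identityʳ a)) ⟩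
                  a + a                            ≈⟨ x+x≈0 a ⟩
                  0#                               ∎
            ... | inj₁ a³+x≈0 = ⊥-elim (no-root a (x+y≈0⇒x≈y a³+x≈0))
            ... | inj₂ aG≈0   = trans (+-identityˡ _) aG≈0

    -- otherwise X^(e+1) + X, of degree e + 1 < q, would vanish on all of F
    ¬∀x^e≈1 : ¬ (∀ x → x ≉ 0# → x ^ e ≈ 1#)
    ¬∀x^e≈1 ∀xᵉ≈1 = binomial-root-bound {d = suc e} {d′ = 1} 1<1+e 1+e<q element (λ i j → element-injective) roots
      where
        1≤e : 1 ℕ.≤ e
        1≤e = let (e′ , e≡1+e′) = e≡1+ in ≡.subst (1 ℕ.≤_) (≡.sym e≡1+e′) (s≤s z≤n)
        1<1+e : 1 ℕ.< suc e
        1<1+e = s≤s 1≤e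
        1+e<q : suc e ℕ.< 2 ℕ.^ m
        1+e<q = ≡.subst (suc e ℕ.<_) (≡.trans (≡.cong suc (ℕₚ.*-comm 3 e)) (≡.sym q≡1+3e))
                  (s≤s (ℕₚ.m<m+n e (ℕₚ.<-≤-trans 1≤e (ℕₚ.m≤m+n e _))))
        roots : ∀ i → element i ^ suc e + element i ^ 1 ≈ 0#
        roots i with element i ≟ 0#
        ... | yes x≈0 = trans (+-cong (trans (*-congʳ x≈0) (zeroˡ _)) (trans (*-identityʳ _) x≈0)) (+-identityʳ 0#)
        ... | no  x≉0 = x≈y⇒x+y≈0 (trans (*-congˡ (∀xᵉ≈1 _ x≉0)) (trans (*-identityʳ _) (sym (*-identityʳ _))))

    generatesModCubes⇔noCubeRoot : ∀ {β} → β ≉ 0# → GeneratesModCubes F β ⇔ (∀ r → r ^ 3 ≉ β)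
    generatesModCubes⇔noCubeRoot {β} β≉0 = mk⇔ no-cube-root generates
      where
        pow≈^ : ∀ x j y → x ≈ β ^ j * y ^ 3 → x ≈ pow F β j * pow F y 3
        pow≈^ x j y x≈βʲy³ = trans x≈βʲy³ (reflexive (≡.sym (≡.cong₂ _*_ (pow≡^ β j) (pow≡^ y 3))))

        no-cube-root : GeneratesModCubes F β → ∀ r → r ^ 3 ≉ β
        no-cube-root generated r r³≈β = ¬∀x^e≈1 (λ x x≉0 →
          let (j , y , y≉0 , x≈βʲy³) = generated x x≉0 in begin
            x ^ e                          ≈⟨ ^-congˡ e (trans x≈βʲy³ (reflexive (≡.cong₂ _*_ (pow≡^ β j) (pow≡^ y 3)))) ⟩
            (β ^ j * y ^ 3) ^ e            ≈⟨ ^-congˡ e (*-congʳ (trans (^-congˡ j (sym r³≈β)) (^-comm r 3 j))) ⟩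
            ((r ^ j) ^ 3 * y ^ 3) ^ e      ≈⟨ ^-congˡ e (^-distrib-* (r ^ j) y 3) ⟨
            ((r ^ j * y) ^ 3) ^ e          ≈⟨ cube^e≈1 (*-≉0 (^-≉0 j r≉0) y≉0) ⟩
            1#                             ∎)
          where
            r≉0 : r ≉ 0#
            r≉0 = ^≉0⇒≉0 2 (λ r³≈0 → β≉0 (trans (sym r³≈β) r³≈0))

        generates : (∀ r → r ^ 3 ≉ β) → GeneratesModCubes F β
        generates no-root x x≉0 with proj₂ isField β β≉0
        ... | β⁻¹ , ββ⁻¹≈1 = cases (cubeRootOfUnity-cases u³≈1 u≉1 xᵉ³≈1)
          where
            u = β ^ e
            u³≈1 : u ^ 3 ≈ 1#
            u³≈1 = trans (^-comm β e 3) (cube^e≈1 β≉0)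
            u≉1 : u ≉ 1#
            u≉1 u≈1 = let (r , r³≈β) = x^e≈1⇒cube β≉0 u≈1 in no-root r r³≈β
            xᵉ³≈1 : (x ^ e) ^ 3 ≈ 1#
            xᵉ³≈1 = trans (^-comm x e 3) (cube^e≈1 x≉0)
            β⁻¹≉0 : β⁻¹ ≉ 0#
            β⁻¹≉0 β⁻¹≈0 = 1≉0 (trans (sym ββ⁻¹≈1) (trans (*-congˡ β⁻¹≈0) (zeroʳ β)))
            [ββ⁻¹]^j≈1 : ∀ j → β ^ j * β⁻¹ ^ j ≈ 1#
            [ββ⁻¹]^j≈1 j = trans (sym (^-distrib-* β β⁻¹ j)) (trans (^-congˡ j ββ⁻¹≈1) (1^n≈1 j))
            witness : ∀ j → x ^ e ≈ u ^ j → ∃₂ λ j′ y → NonZero F y × x ≈ pow F β j′ * pow F y 3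
            witness j xᵉ≈uʲ = j , y , y≉0 , pow≈^ x j y (begin
              x                          ≈⟨ *-identityʳ x ⟨
              x * 1#                     ≈⟨ *-congˡ ([ββ⁻¹]^j≈1 j) ⟨
              x * (β ^ j * β⁻¹ ^ j)      ≈⟨ solve 3 (λ x b c → x :* (b :* c) := b :* (x :* c)) refl x (β ^ j) (β⁻¹ ^ j) ⟩
              β ^ j * z                  ≈⟨ *-congˡ y³≈z ⟨
              β ^ j * y ^ 3              ∎)
              where
                z = x * β⁻¹ ^ j
                zᵉ≈1 : z ^ e ≈ 1#
                zᵉ≈1 = begin
                  (x * β⁻¹ ^ j) ^ e              ≈⟨ ^-distrib-* x (β⁻¹ ^ j) e ⟩
                  x ^ e * (β⁻¹ ^ j) ^ e          ≈⟨ *-cong xᵉ≈uʲ (^-comm β⁻¹ j e) ⟩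
                  (β ^ e) ^ j * (β⁻¹ ^ e) ^ j    ≈⟨ [ββ⁻¹]^j≈1′ ⟩
                  1#                             ∎
                  where
                    [ββ⁻¹]^j≈1′ : (β ^ e) ^ j * (β⁻¹ ^ e) ^ j ≈ 1#
                    [ββ⁻¹]^j≈1′ = trans (sym (^-distrib-* (β ^ e) (β⁻¹ ^ e) j))
                                        (trans (^-congˡ j ([ββ⁻¹]^j≈1 e)) (1^n≈1 j))
                z≉0 = *-≉0 x≉0 (^-≉0 j β⁻¹≉0)
                y = proj₁ (x^e≈1⇒cube z≉0 zᵉ≈1)
                y³≈z = proj₂ (x^e≈1⇒cube z≉0 zᵉ≈1)
                y≉0 : y ≉ 0#
                y≉0 = ^≉0⇒≉0 2 (λ y³≈0 → z≉0 (trans (sym y³≈z) y³≈0))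
            cases : x ^ e ≈ 1# ⊎ x ^ e ≈ u ⊎ x ^ e ≈ u * u → ∃₂ λ j y → NonZero F y × x ≈ pow F β j * pow F y 3
            cases (inj₁ xᵉ≈1)        = witness 0 xᵉ≈1
            cases (inj₂ (inj₁ xᵉ≈u)) = witness 1 (trans xᵉ≈u (sym (*-identityʳ u)))
            cases (inj₂ (inj₂ xᵉ≈u²)) = witness 2 (trans xᵉ≈u² (*-congˡ (sym (*-identityʳ u))))

module Embedding {q : ℕ} (M : ℕ) (k : FiniteField q) (K : FiniteField (2 ℕ.^ M))
                 (ι : FiniteField.Carrier k → FiniteField.Carrier K) (ι-hom : IsEmbedding k K ι) where

  private module k = FieldProperties k
  open FieldProperties K
  open Polynomials K using (binomial-root-bound)
  open Characteristic2 M K using (x≈y⇒x+y≈0)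
  open RingMorphisms (CommutativeRing.rawRing (FiniteField.cring k)) (CommutativeRing.rawRing (FiniteField.cring K))
  open IsRingHomomorphism ι-hom public using (⟦⟧-cong; +-homo; *-homo; 0#-homo; 1#-homo; -‿homo)

  ι-^ : ∀ a j → ι (a k.^ j) ≈ ι a ^ j
  ι-^ a zero    = 1#-homo
  ι-^ a (suc j) = trans (*-homo a _) (*-congˡ (ι-^ a j))

  ι-≉0 : ∀ {a} → a k.≉ k.0# → ι a ≉ 0#
  ι-≉0 {a} a≉0 ιa≈0 with proj₂ k.isField a a≉0
  ... | a⁻¹ , aa⁻¹≈1 = 1≉0 (begin
    1#             ≈⟨ 1#-homo ⟨
    ι k.1#         ≈⟨ ⟦⟧-cong (k.sym aa⁻¹≈1) ⟩
    ι (a k.* a⁻¹)  ≈⟨ *-homo a a⁻¹ ⟩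
    ι a * ι a⁻¹    ≈⟨ *-congʳ ιa≈0 ⟩
    0# * ι a⁻¹     ≈⟨ zeroˡ _ ⟩
    0#             ∎)

  ι-injective : ∀ {a b} → ι a ≈ ι b → a k.≈ b
  ι-injective {a} {b} ιa≈ιb with a k.+ k.- b k.≟ k.0#
  ... | yes a-b≈0 = k.x∙y⁻¹≈ε⇒x≈y a b a-b≈0
  ... | no  a-b≉0 = ⊥-elim (ι-≉0 a-b≉0 (begin
    ι (a k.+ k.- b)    ≈⟨ +-homo a (k.- b) ⟩
    ι a + ι (k.- b)    ≈⟨ +-cong ιa≈ιb (-‿homo b) ⟩
    ι b + - ι b        ≈⟨ -‿inverseʳ (ι b) ⟩
    0#                 ∎))

  ∉InImage⇒≉0 : ∀ {b} → ¬ InImage k K ι b → b ≉ 0#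
  ∉InImage⇒≉0 b∉ι[k] b≈0 = b∉ι[k] (k.0# , trans 0#-homo (sym b≈0))

  ι[a]^q≈ι[a] : ∀ a → ι a ^ q ≈ ι a
  ι[a]^q≈ι[a] a = trans (sym (ι-^ a q)) (⟦⟧-cong (k.x^q≈x a))

  -- k is the fixed field of x ↦ x^q: X^q + X has at most q roots, and all of ι(k) are among them
  fixed⇒InImage : ∀ {b} → b ^ q ≈ b → InImage k K ι b
  fixed⇒InImage {b} bᵠ≈b with Finₚ.any? (λ i → ι (k.element i) ≟ b)
  ... | yes (i , ιi≈b) = k.element i , ιi≈b
  ... | no  b∉ι[k]     = ⊥-elim (binomial-root-bound {d = q} {d′ = 1} k.1<q ℕₚ.≤-refl root root-injective roots)
    where
      root : Fin (suc q) → Carrier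
      root Fin.zero    = b
      root (Fin.suc i) = ι (k.element i)
      root-injective : ∀ i j → root i ≈ root j → i ≡ j
      root-injective Fin.zero    Fin.zero    _   = ≡.refl
      root-injective Fin.zero    (Fin.suc j) b≈ι = ⊥-elim (b∉ι[k] (j , sym b≈ι))
      root-injective (Fin.suc i) Fin.zero    ι≈b = ⊥-elim (b∉ι[k] (i , ι≈b))
      root-injective (Fin.suc i) (Fin.suc j) ι≈ι = ≡.cong Fin.suc (k.element-injective (ι-injective ι≈ι))
      roots : ∀ i → root i ^ q + root i ^ 1 ≈ 0#
      roots Fin.zero    = x≈y⇒x+y≈0 (trans bᵠ≈b (sym (*-identityʳ b)))
      roots (Fin.suc i) = x≈y⇒x+y≈0 (trans (ι[a]^q≈ι[a] _) (sym (*-identityʳ _)))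


module QuadraticExtension (n : ℕ) (k : FiniteField (2 ℕ.^ n)) (α : FiniteField.Carrier k)
                          (α-normal : IsNormalBasis k n α) (K : FiniteField (2 ℕ.^ (2 ℕ.* n)))
                          (ι : FiniteField.Carrier k → FiniteField.Carrier K) (ι-hom : IsEmbedding k K ι) where

  private
    module k where
      open FieldProperties k public
      open Characteristic2 n k public
  open FieldProperties K
  open Sums K
  open Characteristic2 (2 ℕ.* n) K
  open Embedding (2 ℕ.* n) k K ι ι-hom

  q : ℕ
  q = 2 ℕ.^ n

  Tr≈trace[x+xᵠ] : ∀ x → Tr x ≈ trace n (x + x ^ q)
  Tr≈trace[x+xᵠ] x = trans (trace-transitive 2 n x)
    (trace-cong n (+-cong (*-identityʳ x) (trans (+-identityʳ _) (^-congʳ x (ℕₚ.*-identityʳ q)))))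

  Tr∘ι≈0 : ∀ a → Tr (ι a) ≈ 0#
  Tr∘ι≈0 a = trans (Tr≈trace[x+xᵠ] (ι a)) (trans (trace-cong n (x≈y⇒x+y≈0 (sym (ι[a]^q≈ι[a] a)))) (trace-0 n))

  root∉k : ∀ {β} → β * β + β ≈ ι α → ¬ InImage k K ι β
  root∉k {β} β²+β≈ια (b , ιb≈β) = k.normalBasis⇒Tr≉0 α-normal (k.trans (k.trace-cong n (k.sym b²+b≈α)) (k.Tr[x*x+x]≈0 b))
    where
      b²+b≈α : b k.* b k.+ b k.≈ α
      b²+b≈α = ι-injective (begin
        ι (b k.* b k.+ b)   ≈⟨ +-homo (b k.* b) b ⟩
        ι (b k.* b) + ι b   ≈⟨ +-congʳ (*-homo b b) ⟩
        ι b * ι b + ι b     ≈⟨ +-cong (*-cong ιb≈β ιb≈β) ιb≈β ⟩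
        β * β + β           ≈⟨ β²+β≈ια ⟩
        ι α                 ∎)

  ∃root : ∃ λ β → ¬ InImage k K ι β × β * β + β ≈ ι α
  ∃root = let (β , β²+β≈ια) = artin-schreier (Tr∘ι≈0 α) in β , root∉k β²+β≈ια , β²+β≈ια

  module _ {β} (β∉k : ¬ InImage k K ι β) (β²+β≈ια : β * β + β ≈ ι α) where

    -- β^q is the other root of X² + X + ια, so β^q + β ∈ {0, 1}, and β^q ≠ β as β ∉ k
    βᵠ+β≈1 : β ^ q + β ≈ 1#
    βᵠ+β≈1 with x*x≈x⇒x≈0∨x≈1 [βᵠ+β]²≈βᵠ+β
      where
        [βᵠ]²+βᵠ≈ια : β ^ q * β ^ q + β ^ q ≈ ι α
        [βᵠ]²+βᵠ≈ια = begin
          β ^ q * β ^ q + β ^ q     ≈⟨ +-congʳ (^-distrib-* β β q) ⟨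
          (β * β) ^ q + β ^ q       ≈⟨ frobenius-+ n (β * β) β ⟨
          (β * β + β) ^ q           ≈⟨ ^-congˡ q β²+β≈ια ⟩
          ι α ^ q                   ≈⟨ ι[a]^q≈ι[a] α ⟩
          ι α                       ∎
        [βᵠ+β]²≈βᵠ+β : (β ^ q + β) * (β ^ q + β) ≈ β ^ q + β
        [βᵠ+β]²≈βᵠ+β = x+y≈0⇒x≈y (begin
          (β ^ q + β) * (β ^ q + β) + (β ^ q + β)         ≈⟨ +-congʳ ([x+y]²≈x²+y² (β ^ q) β) ⟩
          (β ^ q * β ^ q + β * β) + (β ^ q + β)           ≈⟨ solve 4 (λ u v u² v² → (u² :+ v²) :+ (u :+ v) := (u² :+ u) :+ (v² :+ v)) refl (β ^ q) β (β ^ q * β ^ q) (β * β) ⟩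
          (β ^ q * β ^ q + β ^ q) + (β * β + β)           ≈⟨ x≈y⇒x+y≈0 (trans [βᵠ]²+βᵠ≈ια (sym β²+β≈ια)) ⟩
          0#                                              ∎)
    ... | inj₁ βᵠ+β≈0 = ⊥-elim (β∉k (fixed⇒InImage (x+y≈0⇒x≈y βᵠ+β≈0)))
    ... | inj₂ βᵠ+β≈1 = βᵠ+β≈1

    Trβ≈∑1 : Tr β ≈ ∑[ i < n ] 1#
    Trβ≈∑1 = trans (Tr≈trace[x+xᵠ] β) (trans (trace-cong n (trans (+-comm β _) βᵠ+β≈1)) (trace-1 n))

    quadPoly-irreducible⇔odd : Irreducible K (quadPoly K β) ⇔ (n ℕ.% 2 ≡ 1)
    quadPoly-irreducible⇔odd with ∑[i<k]1-parity n
    ... | inj₁ (n%2≡0 , ∑1≈0) = mk⇔ (λ irreducible → ⊥-elim (reducible irreducible))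
                                    (λ n%2≡1 → ⊥-elim (ℕₚ.0≢1+n (≡.trans (≡.sym n%2≡0) n%2≡1)))
      where
        reducible : ¬ Irreducible K (quadPoly K β)
        reducible irreducible = let (r , r²+r≈β) = artin-schreier (trans Trβ≈∑1 ∑1≈0)
                                in Equivalence.to (quadPoly-irreducible⇔ β) irreducible r r²+r≈β
    ... | inj₂ (n%2≡1 , ∑1≈1) = mk⇔ (λ _ → n%2≡1) (λ _ → Equivalence.from (quadPoly-irreducible⇔ β) no-root)
      where
        no-root : ∀ r → r * r + r ≉ β
        no-root r r²+r≈β = 1≉0 (begin
          1#                ≈⟨ trans Trβ≈∑1 ∑1≈1 ⟨
          Tr β              ≈⟨ trace-cong (2 ℕ.* n) r²+r≈β ⟨
          Tr (r * r + r)    ≈⟨ Tr[x*x+x]≈0 r ⟩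
          0#                ∎)

    cubePoly-irreducible⇔generatesModCubes : 3 ∣ 2 ℕ.^ (2 ℕ.* n) ℕ.∸ 1 →
                                              Irreducible K (cubePoly K β) ⇔ GeneratesModCubes K β
    cubePoly-irreducible⇔generatesModCubes 3∣Q∸1 =
      let (e , Q≡1+3e) = 3∣q∸1⇒q≡1+3e 3∣Q∸1
          open CubeCriterion {e} Q≡1+3e
      in ⇔.trans (cubePoly-irreducible⇔ β) (⇔.sym (generatesModCubes⇔noCubeRoot (∉InImage⇒≉0 β∉k)))

module CubicExtension (n : ℕ) (k : FiniteField (2 ℕ.^ n)) (α : FiniteField.Carrier k)
                      (K : FiniteField (2 ℕ.^ (3 ℕ.* n)))
                      (ι : FiniteField.Carrier k → FiniteField.Carrier K) (ι-hom : IsEmbedding k K ι)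
                      {β : FiniteField.Carrier K} (β∉k : ¬ InImage k K ι β) (β³≈ια : FiniteField._≈_ K (pow K β 3) (ι α)) where

  private module k = FieldProperties k
  open FieldProperties K
  open Characteristic2 (3 ℕ.* n) K
  open Embedding (3 ℕ.* n) k K ι ι-hom

  q : ℕ
  q = 2 ℕ.^ n

  β≉0 : β ≉ 0#
  β≉0 = ∉InImage⇒≉0 β∉k

  α≉0 : α k.≉ k.0#
  α≉0 α≈0 = ^-≉0 3 β≉0 (trans β³≈ια (trans (⟦⟧-cong α≈0) 0#-homo))

  ω : Carrier
  ω = β ^ (q ℕ.∸ 1)

  βᵠ≈βω : β ^ q ≈ β * ω
  βᵠ≈βω = ^-congʳ β k.q≡1+[q∸1]

  ω³≈1 : ω ^ 3 ≈ 1#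
  ω³≈1 = begin
    (β ^ (q ℕ.∸ 1)) ^ 3      ≈⟨ ^-comm β (q ℕ.∸ 1) 3 ⟩
    (β ^ 3) ^ (q ℕ.∸ 1)      ≈⟨ ^-congˡ (q ℕ.∸ 1) β³≈ια ⟩
    ι α ^ (q ℕ.∸ 1)          ≈⟨ ι-^ α (q ℕ.∸ 1) ⟨
    ι (α k.^ (q ℕ.∸ 1))      ≈⟨ ⟦⟧-cong (k.fermat-little k.q≡1+[q∸1] α≉0) ⟩
    ι k.1#                   ≈⟨ 1#-homo ⟩
    1#                       ∎

  ω≉1 : ω ≉ 1#
  ω≉1 ω≈1 = β∉k (fixed⇒InImage (trans βᵠ≈βω (trans (*-congˡ ω≈1) (*-identityʳ β))))

  -- ω ∈ k, so the conjugates β, β^q, β^(q²) are β, βω, βω², which sum to 0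
  quadPoly-reducible : 3 ∣ q ℕ.∸ 1 → ¬ Irreducible K (quadPoly K β)
  quadPoly-reducible 3∣q∸1 irreducible =
    let (r , r²+r≈β) = artin-schreier Trβ≈0 in Equivalence.to (quadPoly-irreducible⇔ β) irreducible r r²+r≈β
    where
      ωᵠ≈ω : ω ^ q ≈ ω
      ωᵠ≈ω = let (t , q≡1+3t) = k.3∣q∸1⇒q≡1+3e 3∣q∸1 in begin
        ω ^ q                    ≈⟨ ^-congʳ ω q≡1+3t ⟩
        ω * ω ^ (t ℕ.* 3)        ≈⟨ *-congˡ (trans (sym (^-assocʳ ω t 3)) (^-comm ω t 3)) ⟩
        ω * (ω ^ 3) ^ t          ≈⟨ *-congˡ (trans (^-congˡ t ω³≈1) (1^n≈1 t)) ⟩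
        ω * 1#                   ≈⟨ *-identityʳ ω ⟩
        ω                        ∎
      β^q²≈βωω : β ^ (q ℕ.* (q ℕ.* 1)) ≈ β * ω * ω
      β^q²≈βωω = begin
        β ^ (q ℕ.* (q ℕ.* 1))    ≈⟨ ^-assocʳ β q (q ℕ.* 1) ⟨
        (β ^ q) ^ (q ℕ.* 1)      ≈⟨ ^-congʳ (β ^ q) (ℕₚ.*-identityʳ q) ⟩
        (β ^ q) ^ q              ≈⟨ ^-congˡ q βᵠ≈βω ⟩
        (β * ω) ^ q              ≈⟨ ^-distrib-* β ω q ⟩
        β ^ q * ω ^ q            ≈⟨ *-cong βᵠ≈βω ωᵠ≈ω ⟩
        β * ω * ω                ∎
      conjugates-sum≈0 : β ^ 1 + (β ^ (q ℕ.* 1) + (β ^ (q ℕ.* (q ℕ.* 1)) + 0#)) ≈ 0#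
      conjugates-sum≈0 = begin
        β ^ 1 + (β ^ (q ℕ.* 1) + (β ^ (q ℕ.* (q ℕ.* 1)) + 0#))
                                  ≈⟨ +-cong (*-identityʳ β) (+-cong (trans (^-congʳ β (ℕₚ.*-identityʳ q)) βᵠ≈βω) (trans (+-identityʳ _) β^q²≈βωω)) ⟩
        β + (β * ω + β * ω * ω)   ≈⟨ solve 2 (λ b w → b :+ (b :* w :+ b :* w :* w) := b :* (con 1 :+ (w :+ w :* w))) refl β ω ⟩
        β * (1# + (ω + ω * ω))    ≈⟨ *-congˡ (1+ω+ω²≈0 ω³≈1 ω≉1) ⟩
        β * 0#                    ≈⟨ zeroʳ β ⟩
        0#                        ∎
      Trβ≈0 : Tr β ≈ 0#
      Trβ≈0 = trans (trace-transitive 3 n β) (trans (trace-cong n conjugates-sum≈0) (trace-0 n))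

  cubePoly-irreducible : V3QuotientIsOne (2 ℕ.^ (3 ℕ.* n) ℕ.∸ 1) (q ℕ.∸ 1) → Irreducible K (cubePoly K β)
  cubePoly-irreducible (m , m[q∸1]≡Q∸1 , divides s m≡s*3 , 9∤m) =
    Equivalence.from (cubePoly-irreducible⇔ β) no-cube-root
    where
      3∤s : ¬ 3 ∣ s
      3∤s (divides t s≡t*3) = 9∤m (divides t (≡.trans m≡s*3 (≡.trans (≡.cong (ℕ._* 3) s≡t*3) (ℕₚ.*-assoc t 3 3))))
      3[q∸1]s≡Q∸1 : 3 ℕ.* (q ℕ.∸ 1) ℕ.* s ≡ 2 ℕ.^ (3 ℕ.* n) ℕ.∸ 1
      3[q∸1]s≡Q∸1 = ≡.trans (ℕₚ.*-comm (3 ℕ.* (q ℕ.∸ 1)) s) (≡.trans (≡.sym (ℕₚ.*-assoc s 3 (q ℕ.∸ 1)))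
                      (≡.trans (≡.cong (ℕ._* (q ℕ.∸ 1)) (≡.sym m≡s*3)) m[q∸1]≡Q∸1))
      no-cube-root : ∀ r → r ^ 3 ≉ β
      no-cube-root r r³≈β = ω≉1 (x³≈1∧xˢ≈1⇒x≈1 s 3∤s ω³≈1 (begin
        ω ^ s                                ≈⟨ ^-congˡ s (^-congˡ (q ℕ.∸ 1) r³≈β) ⟨
        ((r ^ 3) ^ (q ℕ.∸ 1)) ^ s            ≈⟨ trans (^-assocʳ (r ^ 3) (q ℕ.∸ 1) s) (^-assocʳ r 3 ((q ℕ.∸ 1) ℕ.* s)) ⟩
        r ^ (3 ℕ.* ((q ℕ.∸ 1) ℕ.* s))        ≈⟨ ^-congʳ r (≡.trans (≡.sym (ℕₚ.*-assoc 3 (q ℕ.∸ 1) s)) 3[q∸1]s≡Q∸1) ⟩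
        r ^ (2 ℕ.^ (3 ℕ.* n) ℕ.∸ 1)          ≈⟨ fermat-little q≡1+[q∸1] r≉0 ⟩
        1#                                   ∎))
        where
          r≉0 : r ≉ 0#
          r≉0 = ^≉0⇒≉0 2 (λ r³≈0 → β≉0 (trans (sym r³≈β) r³≈0))

open import Data.Nat using (_^_; _∸_; _%_; _*_)

lemma3 : (n : ℕ) (k : FiniteField (2 ^ n)) (α : FiniteField.Carrier k) →
         IsNormalBasis k n α →
         -- Part 1: F_{2^{2n}} ⊇ F_{2^n}
         ((K : FiniteField (2 ^ (2 * n))) (ι : FiniteField.Carrier k → FiniteField.Carrier K) →
          IsEmbedding k K ι →
          (∃ λ β → ¬ InImage k K ι β ×
                   FiniteField._≈_ K (FiniteField._+_ K (FiniteField._*_ K β β) β) (ι α)) ×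
          (∀ β → ¬ InImage k K ι β →
                 FiniteField._≈_ K (FiniteField._+_ K (FiniteField._*_ K β β) β) (ι α) →
                 (Irreducible K (quadPoly K β) ⇔ (n % 2 ≡ 1)) ×
                 (3 ∣ (2 ^ (2 * n) ∸ 1) →
                  (Irreducible K (cubePoly K β) ⇔ GeneratesModCubes K β)))) ×
         -- Part 2: F_{2^{3n}} ⊇ F_{2^n}
         (3 ∣ (2 ^ n ∸ 1) →
          (K : FiniteField (2 ^ (3 * n))) (ι : FiniteField.Carrier k → FiniteField.Carrier K) →
          IsEmbedding k K ι →
          ∀ β → ¬ InImage k K ι β → FiniteField._≈_ K (pow K β 3) (ι α) →
          ¬ Irreducible K (quadPoly K β) ×
          (GeneratesUnits k α → V3QuotientIsOne (2 ^ (3 * n) ∸ 1) (2 ^ n ∸ 1) →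
           Irreducible K (cubePoly K β)))
lemma3 n k α α-normal =
  (λ K ι ι-hom →
     let open QuadraticExtension n k α α-normal K ι ι-hom in
     ∃root , λ β β∉k β²+β≈ια → quadPoly-irreducible⇔odd β∉k β²+β≈ια , cubePoly-irreducible⇔generatesModCubes β∉k β²+β≈ια) ,
  (λ 3∣q∸1 K ι ι-hom β β∉k β³≈ια →
     let open CubicExtension n k α K ι ι-hom β∉k β³≈ια in
     quadPoly-reducible 3∣q∸1 , λ _ → cubePoly-irreducible)
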